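{- Let $q$ be a power of $2$ and let $c\in\mathbb{F}_{q^6}\setminus\mathbb{F}_{q^2}$ satisfy $F_1(c)=F_2(c)=0$ and $F_3(c)\neq 0$, where $$F_1(X)=X^{q^4+2q^3+q^2+q+1}+X^{q^4+q^3+q^2+1}+X^{q^3+q+1}+X+X^{2q^3+q^2+q}+X^{q^3+q^2+q}+X^{q^3}+1,$$ $$F_2(X)=X^{q^3+q^2+2q+2}+X^{q^2+q+2}+X^{q^3+2q^2+2q+1}+X^{2q^3+2q^2+q+1}+X^{q^2+q+1}+X^{q^3+q+1}+X^{q^3+q^2+1}+X+X^{2q^3+q^2+q}+X^{q^3+q^2+q}+X^{q^3}+1,$$ $$F_3(X)=X^{q^2+q+1}+1.$$ Define $$A_1=c^{q^5+q^4+q^3+q^2+2q+1}+c^{q^5+q^3+q^2+2q+1}+c^{q^2+2q+1}+c^{2q+1}+c^{q^4+q^3+q^2+q+1}+c^{q^3+q^2+q+1}+c^{q^5+q^4+q^2+q+1}+c^{q^5+q^2+q+1}+c^{q^4+q^2+1}+c+c^{q^2+2q}+c^{q^5+q^4+q^3+2q}+c^{q^5+q^3+2q}+c^{2q}+c^{q^4+q^3+q}+c^{q^3+q}+c^{q^5+q^4+q}+c^{q^5+q}+c^{q^2}+c^{q^4},$$ $$A_2=c^{q^5+q^4+q^3+q^2+q+1}+c^{q+1}+c^{q^4+q^2+1}+c^{q^5+1}+c^{q^2+q}+c^{q^5+q^3+q}+c^{q^3+q^2}+c^{q^4+q^3}+c^{q^5+q^4}+1,$$ $$A_3=c^{q^5+q^4+q+1}+c^{q^5+q+1}+c^{q+1}+c^{q^4+1}+c^{q}+1,$$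 $$A_4=c^{q^5+q^4+q^3+q^2}+c^{q^4+q^3+q^2}+c^{q^3+q^2}+c^{q^2}+c^{q^5+q^3}+1,$$ and the polynomial $\bar r_3(X,Y,Z)\in\mathbb{F}_{q^6}[X,Y,Z]$ $$\bar r_3=A_1Z+A_1^{q}X+A_2XYZ+A_3YZ^2+(c^{q^2+q+1}+1)^{q^4}XY^2Z^2+A_4X^2Y+(c^{q^2+q+1}+1)^{q^3}X^2Y^2Z.$$ Then $$\bar r_3(X,Y,Z)=(\alpha X+\alpha^{q}Z)(XY+\beta)(YZ+\gamma),$$ where $$\alpha=(c^{q^2+q+1}+1)^{q^3},\qquad \beta=\frac{c^{q^5+q^4+q+1}+c^{q^5+q+1}+c^{q+1}+c^{q^4+1}+c^{q}+1}{\alpha^{q}},$$ $$\gamma=\frac{c^{q^5+q^4+q^3+q^2}+c^{q^4+q^3+q^2}+c^{q^3+q^2}+c^{q^2}+c^{q^5+q^3}+1}{\alpha}.$$ -}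

module Defs where

open import Level using (_⊔_; suc)
open import Algebra.Bundles using (CommutativeRing)
open import Data.Nat as ℕ using (ℕ; zero; _≡ᵇ_)
open import Data.Bool using (if_then_else_; _∧_)
open import Data.Fin using (Fin)
open import Data.List using (List; []; _∷_; _++_; map; concatMap; foldr)
open import Data.Product using (_×_; _,_; ∃)
open import Relation.Nullary using (¬_)
open import Relation.Binary.PropositionalEquality using (_≡_)

record FiniteField (a ℓ : Level.Level) : Set (Level.suc (a ⊔ ℓ)) where
  field
    commRing    : CommutativeRing a ℓ
  open CommutativeRing commRing public
  field
    inv         : Carrier → Carrier
    inv-correct : ∀ x → ¬ (x ≈ 0#) → x * inv x ≈ 1#
    nontrivial  : ¬ (1# ≈ 0#)
    size        : ℕ
    enum        : Fin size → Carrier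
    enum-surj   : ∀ x → ∃ λ i → enum i ≈ x
    enum-inj    : ∀ i j → enum i ≈ enum j → i ≡ j

IsPowerOf2 : ℕ → Set
IsPowerOf2 q = ∃ λ m → (1 ℕ.≤ m) × (q ≡ 2 ℕ.^ m)

module Setup {a ℓ : Level.Level} (K : FiniteField a ℓ) (q : ℕ) where
  open FiniteField K

  pow : Carrier → ℕ → Carrier
  pow x zero      = 1#
  pow x (ℕ.suc n) = x * pow x n

  sumPow : Carrier → List ℕ → Carrier
  sumPow x es = foldr (λ e acc → pow x e + acc) 0# es

  q2 q3 q4 q5 : ℕ
  q2 = q ℕ.^ 2
  q3 = q ℕ.^ 3
  q4 = q ℕ.^ 4
  q5 = q ℕ.^ 5

  F₁ F₂ F₃ : Carrier → Carrier
  F₁ x = sumPow x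
    ( (q4 ℕ.+ 2 ℕ.* q3 ℕ.+ q2 ℕ.+ q ℕ.+ 1) ∷ (q4 ℕ.+ q3 ℕ.+ q2 ℕ.+ 1) ∷ (q3 ℕ.+ q ℕ.+ 1) ∷ 1
    ∷ (2 ℕ.* q3 ℕ.+ q2 ℕ.+ q) ∷ (q3 ℕ.+ q2 ℕ.+ q) ∷ q3 ∷ 0 ∷ [])
  F₂ x = sumPow x
    ( (q3 ℕ.+ q2 ℕ.+ 2 ℕ.* q ℕ.+ 2) ∷ (q2 ℕ.+ q ℕ.+ 2) ∷ (q3 ℕ.+ 2 ℕ.* q2 ℕ.+ 2 ℕ.* q ℕ.+ 1)
    ∷ (2 ℕ.* q3 ℕ.+ 2 ℕ.* q2 ℕ.+ q ℕ.+ 1) ∷ (q2 ℕ.+ q ℕ.+ 1) ∷ (q3 ℕ.+ q ℕ.+ 1)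
    ∷ (q3 ℕ.+ q2 ℕ.+ 1) ∷ 1 ∷ (2 ℕ.* q3 ℕ.+ q2 ℕ.+ q) ∷ (q3 ℕ.+ q2 ℕ.+ q) ∷ q3 ∷ 0 ∷ [])
  F₃ x = sumPow x ((q2 ℕ.+ q ℕ.+ 1) ∷ 0 ∷ [])

  A₁ A₂ A₃ A₄ : Carrier → Carrier
  A₁ c = sumPow c
    ( (q5 ℕ.+ q4 ℕ.+ q3 ℕ.+ q2 ℕ.+ 2 ℕ.* q ℕ.+ 1) ∷ (q5 ℕ.+ q3 ℕ.+ q2 ℕ.+ 2 ℕ.* q ℕ.+ 1)
    ∷ (q2 ℕ.+ 2 ℕ.* q ℕ.+ 1) ∷ (2 ℕ.* q ℕ.+ 1) ∷ (q4 ℕ.+ q3 ℕ.+ q2 ℕ.+ q ℕ.+ 1)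
    ∷ (q3 ℕ.+ q2 ℕ.+ q ℕ.+ 1) ∷ (q5 ℕ.+ q4 ℕ.+ q2 ℕ.+ q ℕ.+ 1) ∷ (q5 ℕ.+ q2 ℕ.+ q ℕ.+ 1)
    ∷ (q4 ℕ.+ q2 ℕ.+ 1) ∷ 1 ∷ (q2 ℕ.+ 2 ℕ.* q) ∷ (q5 ℕ.+ q4 ℕ.+ q3 ℕ.+ 2 ℕ.* q)
    ∷ (q5 ℕ.+ q3 ℕ.+ 2 ℕ.* q) ∷ (2 ℕ.* q) ∷ (q4 ℕ.+ q3 ℕ.+ q) ∷ (q3 ℕ.+ q)
    ∷ (q5 ℕ.+ q4 ℕ.+ q) ∷ (q5 ℕ.+ q) ∷ q2 ∷ q4 ∷ [])
  A₂ c = sumPow c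
    ( (q5 ℕ.+ q4 ℕ.+ q3 ℕ.+ q2 ℕ.+ q ℕ.+ 1) ∷ (q ℕ.+ 1) ∷ (q4 ℕ.+ q2 ℕ.+ 1) ∷ (q5 ℕ.+ 1)
    ∷ (q2 ℕ.+ q) ∷ (q5 ℕ.+ q3 ℕ.+ q) ∷ (q3 ℕ.+ q2) ∷ (q4 ℕ.+ q3) ∷ (q5 ℕ.+ q4) ∷ 0 ∷ [])
  A₃ c = sumPow c
    ( (q5 ℕ.+ q4 ℕ.+ q ℕ.+ 1) ∷ (q5 ℕ.+ q ℕ.+ 1) ∷ (q ℕ.+ 1) ∷ (q4 ℕ.+ 1) ∷ q ∷ 0 ∷ [])
  A₄ c = sumPow c
    ( (q5 ℕ.+ q4 ℕ.+ q3 ℕ.+ q2) ∷ (q4 ℕ.+ q3 ℕ.+ q2) ∷ (q3 ℕ.+ q2) ∷ q2 ∷ (q5 ℕ.+ q3) ∷ 0 ∷ [])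

  -- Formal polynomials in X, Y, Z over the field: a polynomial is a
  -- list of terms  a·X^i Y^j Z^k  (repetitions allowed); its coefficient
  -- at X^i Y^j Z^k is the sum of the matching terms' coefficients.
  Term : Set a
  Term = Carrier × ℕ × ℕ × ℕ

  Poly : Set a
  Poly = List Term

  term : Carrier → ℕ → ℕ → ℕ → Poly
  term x i j k = (x , i , j , k) ∷ []

  _⊕_ : Poly → Poly → Poly
  p ⊕ r = p ++ r

  mulTerm : Term → Term → Term
  mulTerm (x , i , j , k) (y , i′ , j′ , k′) = (x * y , i ℕ.+ i′ , j ℕ.+ j′ , k ℕ.+ k′)

  _⊗_ : Poly → Poly → Poly
  p ⊗ r = concatMap (λ t → map (mulTerm t) r) p

  coeff : Poly → ℕ → ℕ → ℕ → Carrier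
  coeff p i j k = foldr step 0# p
    where
    step : Term → Carrier → Carrier
    step (x , i′ , j′ , k′) acc =
      if (i ≡ᵇ i′) ∧ (j ≡ᵇ j′) ∧ (k ≡ᵇ k′) then x + acc else acc

  _≈ₚ_ : Poly → Poly → Set ℓ
  p ≈ₚ r = ∀ i j k → coeff p i j k ≈ coeff r i j k

  N : Carrier → Carrier
  N c = pow c (q2 ℕ.+ q ℕ.+ 1) + 1#

  r̄₃ : Carrier → Poly
  r̄₃ c =
       term (A₁ c) 0 0 1
    ⊕ (term (pow (A₁ c) q) 1 0 0
    ⊕ (term (A₂ c) 1 1 1
    ⊕ (term (A₃ c) 0 1 2
    ⊕ (term (pow (N c) q4) 1 2 2
    ⊕ (term (A₄ c) 2 1 0
    ⊕  term (pow (N c) q3) 2 2 1)))))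

  α β γ : Carrier → Carrier
  α c = pow (N c) q3
  β c = A₃ c * inv (pow (α c) q)
  γ c = A₄ c * inv (α c)

  factored : Carrier → Poly
  factored c =
    ((term (α c) 1 0 0 ⊕ term (pow (α c) q) 0 0 1)
      ⊗ (term 1# 1 1 0 ⊕ term (β c) 0 0 0))
      ⊗ (term 1# 0 1 1 ⊕ term (γ c) 0 0 0)

module Submission where

open import Defs
open import Level using (Level)
open import Data.Bool using (true; false; _∧_)
open import Data.Empty using (⊥-elim)
open import Data.Fin as Fin using (Fin; toℕ)
open import Data.Fin.Patterns using (0F; 1F; 2F; 3F; 4F; 5F)
import Data.Fin.Properties as Fin
open import Data.Fin.Permutation using (Permutation; permutation)
open import Data.List as List using (List; []; _∷_)
open import Data.Nat as ℕ using (ℕ; zero; suc; _^_; _≡ᵇ_; compare; less; equal; greater)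
import Data.Nat.Properties as ℕ
open import Data.Product using (_,_; proj₁; proj₂)
open import Data.Vec as Vec using (Vec; []; _∷_)
import Data.Vec.Properties as Vec
open import Function.Bundles using (Inverse)
open import Relation.Nullary using (¬_; Dec; yes; no)
open import Relation.Binary.PropositionalEquality as ≡ using (_≡_; _≢_)
open import Algebra.Bundles using (CommutativeMonoid)
import Algebra.Properties.CommutativeMonoid.Sum as Sum
import Algebra.Properties.Group as AlgebraGroup
import Algebra.Properties.Semiring.Mult as Mult

-- Write xᵢ = c^(qⁱ), i < 6, for the conjugates of c. As q is a power of 2 and
-- c^(q⁶) = c (Fermat), x ↦ x^q is additive and permutes x₀, …, x₅ cyclically.
-- Every exponent in the statement has base-q digits at most 2, so all the
-- quantities involved are 𝔽₂-polynomials in x₀, …, x₅, and F₁(c) = F₂(c) = 0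
-- yields the relations σᵏF₁ = 0 and σᵏH = 0 for the cyclic shift σ, where
-- F₁ + F₂ = x₀x₂·H (H vanishes as c ≠ 0, the only use of c ∉ 𝔽_{q²}).
-- With β and γ as in the statement, comparing coefficients reduces the
-- factorisation to A₃A₄ = A₁α, A₃A₄ = A₁^q α^q and A₃α² + A₄α^{2q} = A₂αα^q,
-- using α ≠ 0, which holds as F₃(c) ≠ 0. Each of the three is an explicit
-- combination Σ g·σᵏR of the relations, verified by normalising both sides.

-- A polynomial over 𝔽₂ is a list of exponent vectors; norm computes its sorted,
-- duplicate-free form, and merge (addition) cancels a monomial common to both.
module 𝔽₂Poly where
  open import Data.Product using (_×_)

  Monomial : ℕ → Set
  Monomial n = Vec ℕ n

  Poly : ℕ → Set
  Poly n = List (Monomial n)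

  data Order {n} (u v : Monomial n) : Set where
    before after : Order u v
    same         : u ≡ v → Order u v

  compareMonomial : ∀ {n} (u v : Monomial n) → Order u v
  compareMonomial []      []      = same ≡.refl
  compareMonomial (a ∷ u) (b ∷ v) with compare a b
  ... | less _ _    = before
  ... | greater _ _ = after
  ... | equal _ with compareMonomial u v
  ...   | before      = before
  ...   | after       = after
  ...   | same ≡.refl = same ≡.refl

  merge : ∀ {n} → Poly n → Poly n → Poly n
  merge []          r = r
  merge {n} (u ∷ p) r = go r
    where
    go : Poly n → Poly n
    go []      = u ∷ p
    go (v ∷ r) with compareMonomial u v
    ... | before = u ∷ merge p (v ∷ r)
    ... | after  = v ∷ go r
    ... | same _ = merge p r

  _·ₘ_ : ∀ {n} → Monomial n → Monomial n → Monomial n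
  _·ₘ_ = Vec.zipWith ℕ._+_

  multiply : ∀ {n} → Poly n → Poly n → Poly n
  multiply []      r = []
  multiply (u ∷ p) r = merge (List.map (u ·ₘ_) r) (multiply p r)

  normalise : ∀ {n} → Poly n → Poly n
  normalise []      = []
  normalise (u ∷ p) = merge (u ∷ []) (normalise p)

  infixl 6 _⊕_
  infixl 7 _⊗_

  data Expr (n : ℕ) : Set where
    lit     : Poly n → Expr n
    _⊕_ _⊗_ : Expr n → Expr n → Expr n

  norm : ∀ {n} → Expr n → Poly n
  norm (lit p) = normalise p
  norm (e ⊕ f) = merge (norm e) (norm f)
  norm (e ⊗ f) = multiply (norm e) (norm f)

  linearCombination : ∀ {n} {R : Set} → (R → Poly n) → List (Poly n × R) → Poly n
  linearCombination rel []             = []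
  linearCombination rel ((g , r) ∷ cs) =
    merge (multiply (normalise g) (normalise (rel r))) (linearCombination rel cs)

-- Exponents of c written in base q. An exponent with digit vector (a₀, …, a₅)
-- turns c^e into the monomial x₀^a₀ ⋯ x₅^a₅ in the conjugates xᵢ = c^(qⁱ).
module BaseQ where
  open 𝔽₂Poly

  infixl 6 _+_
  infixl 7 _·_
  infix  9 #_ 𝐪^_

  -- 𝐪 is separate from 𝐪^ 1F because value q (𝐪^ 1F) is q ^ 1, not q.
  data Exponent : Set where
    #_  : ℕ → Exponent
    𝐪   : Exponent
    𝐪^_ : Fin 6 → Exponent
    _+_ : Exponent → Exponent → Exponent
    _·_ : ℕ → Exponent → Exponent

  value : ℕ → Exponent → ℕ
  value q (# n)   = n
  value q 𝐪       = q
  value q (𝐪^ i)  = q ^ toℕ i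
  value q (e + f) = value q e ℕ.+ value q f
  value q (k · e) = k ℕ.* value q e

  unit : Fin 6 → Monomial 6
  unit i = Vec.replicate 6 0 Vec.[ i ]≔ 1

  digits : Exponent → Monomial 6
  digits (# n)   = n ∷ Vec.replicate 5 0
  digits 𝐪       = unit 1F
  digits (𝐪^ i)  = unit i
  digits (e + f) = digits e ·ₘ digits f
  digits (k · e) = Vec.map (k ℕ.*_) (digits e)

  -- The action of x ↦ x^q: it sends xᵢ to xᵢ₊₁, and x₅ to c^(q⁶) = x₀.
  σ : Monomial 6 → Monomial 6
  σ (a ∷ b ∷ c ∷ d ∷ e ∷ f ∷ []) = f ∷ a ∷ b ∷ c ∷ d ∷ e ∷ []

  σ^ : ℕ → Poly 6 → Poly 6
  σ^ zero    p = p
  σ^ (suc k) p = List.map σ (σ^ k p)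

-- pow is only available as Setup.pow K q, whence the parameter q.
module FiniteFieldFacts {a ℓ} (K : FiniteField a ℓ) (q : ℕ) where
  open FiniteField K
  open Setup K q using (pow; Term; coeff) renaming (Poly to PolyXYZ)
  open 𝔽₂Poly
  open import Relation.Binary.Reasoning.Setoid setoid
  open import Algebra.Solver.Ring.NaturalCoefficients.Default commutativeSemiring
    using (solve; _:=_; _:*_; _:+_; con)

  pow-cong : ∀ {x y} n → x ≈ y → pow x n ≈ pow y n
  pow-cong zero    x≈y = refl
  pow-cong (suc n) x≈y = *-cong x≈y (pow-cong n x≈y)

  pow-+ : ∀ x m n → pow x (m ℕ.+ n) ≈ pow x m * pow x n
  pow-+ x zero    n = sym (*-identityˡ _)
  pow-+ x (suc m) n = trans (*-congˡ (pow-+ x m n)) (sym (*-assoc _ _ _))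

  pow-* : ∀ x m n → pow x (m ℕ.* n) ≈ pow (pow x n) m
  pow-* x zero    n = refl
  pow-* x (suc m) n = trans (pow-+ x n (m ℕ.* n)) (*-congˡ (pow-* x m n))

  pow-pow-comm : ∀ x m n → pow (pow x m) n ≈ pow (pow x n) m
  pow-pow-comm x m n = begin
    pow (pow x m) n ≈⟨ pow-* x n m ⟨
    pow x (n ℕ.* m) ≡⟨ ≡.cong (pow x) (ℕ.*-comm n m) ⟩
    pow x (m ℕ.* n) ≈⟨ pow-* x m n ⟩
    pow (pow x n) m ∎

  pow-distrib-* : ∀ x y n → pow (x * y) n ≈ pow x n * pow y n
  pow-distrib-* x y zero    = sym (*-identityˡ _)
  pow-distrib-* x y (suc n) = trans (*-congˡ (pow-distrib-* x y n))
    (solve 4 (λ x y u v → (x :* y) :* (u :* v) := (x :* u) :* (y :* v)) refl x y (pow x n) (pow y n))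

  pow-1# : ∀ n → pow 1# n ≈ 1#
  pow-1# zero    = refl
  pow-1# (suc n) = trans (*-identityˡ _) (pow-1# n)

  pow-0# : ∀ {n} → Fin n → pow 0# n ≈ 0#
  pow-0# {suc n} _ = zeroˡ _

  *-inverse-cancelʳ : ∀ x {w} → w ≉ 0# → (x * w) * inv w ≈ x
  *-inverse-cancelʳ x {w} w≉0 =
    trans (*-assoc x w (inv w)) (trans (*-congˡ (inv-correct w w≉0)) (*-identityʳ x))

  *-cancelʳ : ∀ {u v w} → w ≉ 0# → u * w ≈ v * w → u ≈ v
  *-cancelʳ {u} {v} w≉0 uw≈vw =
    trans (sym (*-inverse-cancelʳ u w≉0)) (trans (*-congʳ uw≈vw) (*-inverse-cancelʳ v w≉0))

  *-≉0 : ∀ {x y} → x ≉ 0# → y ≉ 0# → x * y ≉ 0#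
  *-≉0 x≉0 y≉0 xy≈0 = y≉0 (*-cancelʳ x≉0 (trans (*-comm _ _) (trans xy≈0 (sym (zeroˡ _)))))

  pow-≉0 : ∀ {x} n → x ≉ 0# → pow x n ≉ 0#
  pow-≉0 zero    x≉0 = nontrivial
  pow-≉0 (suc n) x≉0 = *-≉0 x≉0 (pow-≉0 n x≉0)

  index : Carrier → Fin size
  index x = proj₁ (enum-surj x)

  enum-index : ∀ x → enum (index x) ≈ x
  enum-index x = proj₂ (enum-surj x)

  infix 4 _≈?_
  _≈?_ : ∀ x y → Dec (x ≈ y)
  x ≈? y with index x Fin.≟ index y
  ... | yes i≡j = yes (trans (sym (enum-index x)) (trans (reflexive (≡.cong enum i≡j)) (enum-index y)))
  ... | no  i≢j = no (λ x≈y → i≢j (enum-inj _ _ (trans (enum-index x) (trans x≈y (sym (enum-index y))))))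

  enumPermutation : Inverse setoid setoid → Permutation size size
  enumPermutation F = permutation (λ i → index (to (enum i))) (λ i → index (from (enum i)))
    (λ i → enum-inj _ _ (trans (enum-index _) (trans (to-cong (enum-index _)) (strictlyInverseˡ (enum i)))))
    (λ i → enum-inj _ _ (trans (enum-index _) (trans (from-cong (enum-index _)) (strictlyInverseʳ (enum i)))))
    where open Inverse F

  sum-invariant : ∀ {c ℓ′} (M : CommutativeMonoid c ℓ′) (F : Inverse setoid setoid)
    (h : Carrier → CommutativeMonoid.Carrier M) →
    (∀ {x y} → x ≈ y → CommutativeMonoid._≈_ M (h x) (h y)) →
    let open Sum M using (sum) in
    CommutativeMonoid._≈_ M (sum (λ i → h (enum i))) (sum (λ i → h (Inverse.to F (enum i))))
  sum-invariant M F h h-cong = M.trans (sum-permute (λ i → h (enum i)) (enumPermutation F))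
    (sum-cong-≋ {size} (λ i → h-cong (enum-index _)))
    where
    module M = CommutativeMonoid M
    open Sum M using (sum-permute; sum-cong-≋)

  translation : Carrier → Inverse setoid setoid
  translation x = record
    { to        = x +_
    ; from      = - x +_
    ; to-cong   = +-congˡ
    ; from-cong = +-congˡ
    ; inverse   = (λ y≈ → trans (+-congˡ y≈) (cancel x (- x) (-‿inverseʳ x)))
                , (λ y≈ → trans (+-congˡ y≈) (cancel (- x) x (-‿inverseˡ x)))
    }
    where
    cancel : ∀ u v {z} → u + v ≈ 0# → u + (v + z) ≈ z
    cancel u v {z} u+v≈0 = trans (sym (+-assoc u v z)) (trans (+-congʳ u+v≈0) (+-identityˡ z))

  dilation : ∀ x → x ≉ 0# → Inverse setoid setoid
  dilation x x≉0 = record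
    { to        = x *_
    ; from      = inv x *_
    ; to-cong   = *-congˡ
    ; from-cong = *-congˡ
    ; inverse   = (λ y≈ → trans (*-congˡ y≈) (cancel x (inv x) (inv-correct x x≉0)))
                , (λ y≈ → trans (*-congˡ y≈) (cancel (inv x) x (trans (*-comm _ _) (inv-correct x x≉0))))
    }
    where
    cancel : ∀ u v {z} → u * v ≈ 1# → u * (v * z) ≈ z
    cancel u v {z} uv≈1 = trans (sym (*-assoc u v z)) (trans (*-congʳ uv≈1) (*-identityˡ z))

  open Sum +-commutativeMonoid using (sum; sum-replicate; ∑-distrib-+)
  open Mult semiring using (_×_; ×1-homo-*)
  open AlgebraGroup +-group using (identityˡ-unique)

  size×x≈0 : ∀ x → size × x ≈ 0#
  size×x≈0 x = begin
    size × x              ≈⟨ sum-replicate size ⟨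
    sum {size} (λ _ → x)  ≈⟨ identityˡ-unique _ (sum enum) translated ⟩
    0#                    ∎
    where
    translated : sum {size} (λ _ → x) + sum enum ≈ sum enum
    translated = trans (sym (∑-distrib-+ (λ _ → x) enum))
      (sym (sum-invariant +-commutativeMonoid (translation x) (λ y → y) (λ y≈z → y≈z)))

  ^×1 : ∀ b n → (b ^ n) × 1# ≈ pow (b × 1#) n
  ^×1 b zero    = +-identityʳ 1#
  ^×1 b (suc n) = trans (×1-homo-* b (b ^ n)) (*-congˡ (^×1 b n))

  characteristic-two : ∀ n → size ≡ 2 ^ n → 1# + 1# ≈ 0#
  characteristic-two n size≡2ⁿ with 2 × 1# ≈? 0#
  ... | yes 2≈0 = trans (+-congˡ (sym (+-identityʳ 1#))) 2≈0
  ... | no  2≉0 = ⊥-elim (pow-≉0 n 2≉0 (begin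
    pow (2 × 1#) n  ≈⟨ ^×1 2 n ⟨
    (2 ^ n) × 1#    ≡⟨ ≡.cong (_× 1#) size≡2ⁿ ⟨
    size × 1#       ≈⟨ size×x≈0 1# ⟩
    0#              ∎))

  module ∏ = Sum *-commutativeMonoid

  ∏≈pow : ∀ {n} x (f : Fin n → Carrier) → (∀ i → f i ≈ x) → ∏.sum f ≈ pow x n
  ∏≈pow {zero}  x f f≈x = refl
  ∏≈pow {suc n} x f f≈x = *-cong (f≈x Fin.zero) (∏≈pow x (λ i → f (Fin.suc i)) (λ i → f≈x (Fin.suc i)))

  x*∏≈pow : ∀ {n} x (f : Fin n → Carrier) i₀ → f i₀ ≈ 1# → (∀ i → i ≢ i₀ → f i ≈ x) →
            x * ∏.sum f ≈ pow x n
  x*∏≈pow x f Fin.zero f₀≈1 f≈x = *-congˡ (trans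
    (*-congʳ f₀≈1) (trans (*-identityˡ _) (∏≈pow x _ (λ i → f≈x (Fin.suc i) λ ()))))
  x*∏≈pow x f (Fin.suc i₀) fᵢ₀≈1 f≈x = *-congˡ (trans
    (*-congʳ (f≈x Fin.zero λ ()))
    (x*∏≈pow x (λ i → f (Fin.suc i)) i₀ fᵢ₀≈1 (λ i i≢i₀ → f≈x (Fin.suc i) (λ eq → i≢i₀ (Fin.suc-injective eq)))))

  -- Fermat: e ↦ x * e permutes the field, so the product of zeroToOne over it
  -- is unchanged, while each factor e ≠ 0 gets multiplied by x.
  zeroToOne : Carrier → Carrier
  zeroToOne e with e ≈? 0#
  ... | yes _ = 1#
  ... | no  _ = e

  zeroToOne-≉0 : ∀ e → zeroToOne e ≉ 0#
  zeroToOne-≉0 e with e ≈? 0#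
  ... | yes _   = nontrivial
  ... | no  e≉0 = e≉0

  zeroToOne-cong : ∀ {u v} → u ≈ v → zeroToOne u ≈ zeroToOne v
  zeroToOne-cong {u} {v} u≈v with u ≈? 0# | v ≈? 0#
  ... | yes _   | yes _   = refl
  ... | yes u≈0 | no  v≉0 = ⊥-elim (v≉0 (trans (sym u≈v) u≈0))
  ... | no  u≉0 | yes v≈0 = ⊥-elim (u≉0 (trans u≈v v≈0))
  ... | no  _   | no  _   = u≈v

  module _ (x : Carrier) (x≉0 : x ≉ 0#) where

    factor : Carrier → Carrier
    factor e with e ≈? 0#
    ... | yes _ = 1#
    ... | no  _ = x

    zeroToOne-* : ∀ e → zeroToOne (x * e) ≈ factor e * zeroToOne e
    zeroToOne-* e with e ≈? 0# | x * e ≈? 0#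
    ... | yes _   | yes _    = sym (*-identityˡ _)
    ... | yes e≈0 | no  xe≉0 = ⊥-elim (xe≉0 (trans (*-congˡ e≈0) (zeroʳ x)))
    ... | no  e≉0 | yes xe≈0 = ⊥-elim (*-≉0 x≉0 e≉0 xe≈0)
    ... | no  _   | no  _    = refl

    ∏factor≈1 : ∏.sum (λ i → factor (enum i)) ≈ 1#
    ∏factor≈1 = *-cancelʳ (∏≉0 (λ i → zeroToOne-≉0 (enum i))) (begin
      ∏.sum (λ i → factor (enum i)) * P
        ≈⟨ ∏.∑-distrib-+ (λ i → factor (enum i)) (λ i → zeroToOne (enum i)) ⟨
      ∏.sum (λ i → factor (enum i) * zeroToOne (enum i))
        ≈⟨ ∏.sum-cong-≋ {size} (λ i → sym (zeroToOne-* (enum i))) ⟩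
      ∏.sum (λ i → zeroToOne (x * enum i))
        ≈⟨ sum-invariant *-commutativeMonoid (dilation x x≉0) zeroToOne zeroToOne-cong ⟨
      P
        ≈⟨ *-identityˡ P ⟨
      1# * P ∎)
      where
      P : Carrier
      P = ∏.sum (λ i → zeroToOne (enum i))
      ∏≉0 : ∀ {n} {f : Fin n → Carrier} → (∀ i → f i ≉ 0#) → ∏.sum f ≉ 0#
      ∏≉0 {zero}  f≉0 = nontrivial
      ∏≉0 {suc n} f≉0 = *-≉0 (f≉0 Fin.zero) (∏≉0 (λ i → f≉0 (Fin.suc i)))

    fermat : pow x size ≈ x
    fermat = begin
      pow x size                         ≈⟨ x*∏≈pow x (λ i → factor (enum i)) (index 0#) factor₀≈1 factor≈x ⟨
      x * ∏.sum (λ i → factor (enum i))  ≈⟨ *-congˡ ∏factor≈1 ⟩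
      x * 1#                             ≈⟨ *-identityʳ x ⟩
      x                                  ∎
      where
      factor₀≈1 : factor (enum (index 0#)) ≈ 1#
      factor₀≈1 with enum (index 0#) ≈? 0#
      ... | yes _ = refl
      ... | no  e≉0 = ⊥-elim (e≉0 (enum-index 0#))
      factor≈x : ∀ i → i ≢ index 0# → factor (enum i) ≈ x
      factor≈x i i≢i₀ with enum i ≈? 0#
      ... | yes e≈0 = ⊥-elim (i≢i₀ (enum-inj _ _ (trans e≈0 (sym (enum-index 0#)))))
      ... | no  _   = refl

  pow-size : ∀ x → pow x size ≈ x
  pow-size x with x ≈? 0#
  ... | yes x≈0 = trans (pow-cong size x≈0) (trans (pow-0# (index 0#)) (sym x≈0))
  ... | no  x≉0 = fermat x x≉0

  evalMonomial : ∀ {n} → Vec Carrier n → Monomial n → Carrier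
  evalMonomial []       []       = 1#
  evalMonomial (x ∷ xs) (e ∷ es) = pow x e * evalMonomial xs es

  evalMonomial-·ₘ : ∀ {n} (xs : Vec Carrier n) u v →
                    evalMonomial xs (u ·ₘ v) ≈ evalMonomial xs u * evalMonomial xs v
  evalMonomial-·ₘ []       []       []       = sym (*-identityˡ 1#)
  evalMonomial-·ₘ (x ∷ xs) (d ∷ u) (e ∷ v) = begin
    pow x (d ℕ.+ e) * evalMonomial xs (u ·ₘ v)
      ≈⟨ *-cong (pow-+ x d e) (evalMonomial-·ₘ xs u v) ⟩
    (pow x d * pow x e) * (evalMonomial xs u * evalMonomial xs v)
      ≈⟨ solve 4 (λ a b c d → (a :* b) :* (c :* d) := (a :* c) :* (b :* d)) refl _ _ _ _ ⟩
    (pow x d * evalMonomial xs u) * (pow x e * evalMonomial xs v) ∎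

  pow-evalMonomial-exponents : ∀ {n} (xs : Vec Carrier n) u k →
                               pow (evalMonomial xs u) k ≈ evalMonomial xs (Vec.map (k ℕ.*_) u)
  pow-evalMonomial-exponents []       []      k = pow-1# k
  pow-evalMonomial-exponents (x ∷ xs) (e ∷ u) k = trans (pow-distrib-* _ _ k)
    (*-cong (sym (pow-* x k e)) (pow-evalMonomial-exponents xs u k))

  pow-evalMonomial-variables : ∀ {n} (xs : Vec Carrier n) u k →
                               pow (evalMonomial xs u) k ≈ evalMonomial (Vec.map (λ x → pow x k) xs) u
  pow-evalMonomial-variables []       []      k = pow-1# k
  pow-evalMonomial-variables (x ∷ xs) (e ∷ u) k = trans (pow-distrib-* _ _ k)
    (*-cong (pow-pow-comm x e k) (pow-evalMonomial-variables xs u k))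

  evalMonomial-0 : ∀ {n} (xs : Vec Carrier n) → evalMonomial xs (Vec.replicate n 0) ≈ 1#
  evalMonomial-0 []       = refl
  evalMonomial-0 (x ∷ xs) = trans (*-identityˡ _) (evalMonomial-0 xs)

  evalMonomial-unit : ∀ {n} (xs : Vec Carrier n) i →
                      evalMonomial xs (Vec.replicate n 0 Vec.[ i ]≔ 1) ≈ Vec.lookup xs i
  evalMonomial-unit (x ∷ xs) Fin.zero    =
    trans (*-congʳ (*-identityʳ x)) (trans (*-congˡ (evalMonomial-0 xs)) (*-identityʳ x))
  evalMonomial-unit (x ∷ xs) (Fin.suc i) = trans (*-identityˡ _) (evalMonomial-unit xs i)

  evalMonomial-≉0 : ∀ {n} (xs : Vec Carrier n) u → (∀ i → Vec.lookup xs i ≉ 0#) → evalMonomial xs u ≉ 0#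
  evalMonomial-≉0 []       []      _   = nontrivial
  evalMonomial-≉0 (x ∷ xs) (e ∷ u) xs≉0 =
    *-≉0 (pow-≉0 e (xs≉0 Fin.zero)) (evalMonomial-≉0 xs u (λ i → xs≉0 (Fin.suc i)))

  eval : ∀ {n} → Vec Carrier n → Poly n → Carrier
  eval xs []      = 0#
  eval xs (u ∷ p) = evalMonomial xs u + eval xs p

  ⟦_⟧ : ∀ {n} → Expr n → Vec Carrier n → Carrier
  ⟦ lit p ⟧ xs = eval xs p
  ⟦ e ⊕ f ⟧ xs = ⟦ e ⟧ xs + ⟦ f ⟧ xs
  ⟦ e ⊗ f ⟧ xs = ⟦ e ⟧ xs * ⟦ f ⟧ xs

  module CoefficientAt (i j k : ℕ) where

    ⟨_⟩ : Term → Carrier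
    ⟨ t ⟩ = coeff (t ∷ []) i j k

    Σ⟨_⟩ : PolyXYZ → Carrier
    Σ⟨ [] ⟩    = 0#
    Σ⟨ t ∷ p ⟩ = ⟨ t ⟩ + Σ⟨ p ⟩

    coeff-as-sum : ∀ p → coeff p i j k ≈ Σ⟨ p ⟩
    coeff-as-sum []                      = refl
    coeff-as-sum ((x , i′ , j′ , k′) ∷ p) with (i ≡ᵇ i′) ∧ (j ≡ᵇ j′) ∧ (k ≡ᵇ k′)
    ... | true  = +-cong (sym (+-identityʳ x)) (coeff-as-sum p)
    ... | false = trans (coeff-as-sum p) (sym (+-identityˡ _))

    ⟨⟩-cong : ∀ {x y} i′ j′ k′ → x ≈ y → ⟨ (x , i′ , j′ , k′) ⟩ ≈ ⟨ (y , i′ , j′ , k′) ⟩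
    ⟨⟩-cong i′ j′ k′ x≈y with (i ≡ᵇ i′) ∧ (j ≡ᵇ j′) ∧ (k ≡ᵇ k′)
    ... | true  = +-congʳ x≈y
    ... | false = refl

    ⟨⟩-+ : ∀ x y i′ j′ k′ → ⟨ (x , i′ , j′ , k′) ⟩ + ⟨ (y , i′ , j′ , k′) ⟩ ≈ ⟨ (x + y , i′ , j′ , k′) ⟩
    ⟨⟩-+ x y i′ j′ k′ with (i ≡ᵇ i′) ∧ (j ≡ᵇ j′) ∧ (k ≡ᵇ k′)
    ... | true  = trans (+-congʳ (+-identityʳ x)) (sym (+-assoc x y 0#))
    ... | false = +-identityʳ 0#

  module CharacteristicTwo (1+1≈0 : 1# + 1# ≈ 0#) where

    x+x≈0 : ∀ x → x + x ≈ 0#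
    x+x≈0 x = begin
      x + x           ≈⟨ solve 1 (λ x → x :+ x := (con 1 :+ con 1) :* x) refl x ⟩
      (1# + 1#) * x   ≈⟨ *-congʳ 1+1≈0 ⟩
      0# * x          ≈⟨ zeroˡ x ⟩
      0#              ∎

    x+y≈0⇒x≈y : ∀ {x y} → x + y ≈ 0# → x ≈ y
    x+y≈0⇒x≈y {x} {y} x+y≈0 = begin
      x              ≈⟨ +-identityʳ x ⟨
      x + 0#         ≈⟨ +-congˡ (x+x≈0 y) ⟨
      x + (y + y)    ≈⟨ +-assoc x y y ⟨
      (x + y) + y    ≈⟨ +-congʳ x+y≈0 ⟩
      0# + y         ≈⟨ +-identityˡ y ⟩
      y              ∎

    frobenius : ∀ m x y → pow (x + y) (2 ^ m) ≈ pow x (2 ^ m) + pow y (2 ^ m)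
    frobenius zero    x y = solve 2 (λ x y → (x :+ y) :* con 1 := x :* con 1 :+ y :* con 1) refl x y
    frobenius (suc m) x y = begin
      pow (x + y) (2 ℕ.* k)               ≈⟨ pow-* (x + y) 2 k ⟩
      pow (pow (x + y) k) 2               ≈⟨ pow-cong 2 (frobenius m x y) ⟩
      pow (pow x k + pow y k) 2           ≈⟨ square-+ (pow x k) (pow y k) ⟩
      pow (pow x k) 2 + pow (pow y k) 2   ≈⟨ +-cong (pow-* x 2 k) (pow-* y 2 k) ⟨
      pow x (2 ℕ.* k) + pow y (2 ℕ.* k)   ∎
      where
      k : ℕ
      k = 2 ^ m
      square-+ : ∀ u v → pow (u + v) 2 ≈ pow u 2 + pow v 2
      square-+ u v = begin
        pow (u + v) 2
          ≈⟨ solve 2 (λ u v → (u :+ v) :* ((u :+ v) :* con 1)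
                             := (u :* (u :* con 1) :+ v :* (v :* con 1)) :+ (u :* v :+ u :* v)) refl u v ⟩
        (pow u 2 + pow v 2) + (u * v + u * v)
          ≈⟨ +-congˡ (x+x≈0 (u * v)) ⟩
        (pow u 2 + pow v 2) + 0#
          ≈⟨ +-identityʳ _ ⟩
        pow u 2 + pow v 2 ∎

    module _ {n} (xs : Vec Carrier n) where

      eval-merge : ∀ p r → eval xs (merge p r) ≈ eval xs p + eval xs r
      eval-merge []      r = sym (+-identityˡ _)
      eval-merge (u ∷ p) r = go r
        where
        go : ∀ r → eval xs (merge (u ∷ p) r) ≈ eval xs (u ∷ p) + eval xs r
        go []      = sym (+-identityʳ _)
        go (v ∷ r) with compareMonomial u v
        ... | before    = trans (+-congˡ (eval-merge p (v ∷ r))) (sym (+-assoc _ _ _))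
        ... | after     = trans (+-congˡ (go r))
          (solve 3 (λ a b c → b :+ (a :+ c) := a :+ (b :+ c)) refl
                   (eval xs (u ∷ p)) (evalMonomial xs v) (eval xs r))
        ... | same ≡.refl = begin
          eval xs (merge p r)                          ≈⟨ eval-merge p r ⟩
          eval xs p + eval xs r                        ≈⟨ +-identityˡ _ ⟨
          0# + (eval xs p + eval xs r)                 ≈⟨ +-congʳ (x+x≈0 (evalMonomial xs u)) ⟨
          (U + U) + (eval xs p + eval xs r)            ≈⟨ solve 3 (λ a b c → (a :+ a) :+ (b :+ c) := (a :+ b) :+ (a :+ c))
                                                                  refl U (eval xs p) (eval xs r) ⟩
          (U + eval xs p) + (U + eval xs r)            ∎
          where
          U : Carrier
          U = evalMonomial xs u

      eval-scale : ∀ u p → eval xs (List.map (u ·ₘ_) p) ≈ evalMonomial xs u * eval xs p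
      eval-scale u []      = sym (zeroʳ _)
      eval-scale u (v ∷ p) = trans (+-cong (evalMonomial-·ₘ xs u v) (eval-scale u p)) (sym (distribˡ _ _ _))

      eval-multiply : ∀ p r → eval xs (multiply p r) ≈ eval xs p * eval xs r
      eval-multiply []      r = sym (zeroˡ _)
      eval-multiply (u ∷ p) r = trans (eval-merge (List.map (u ·ₘ_) r) (multiply p r))
        (trans (+-cong (eval-scale u r) (eval-multiply p r)) (sym (distribʳ _ _ _)))

      eval-normalise : ∀ p → eval xs (normalise p) ≈ eval xs p
      eval-normalise []      = refl
      eval-normalise (u ∷ p) = trans (eval-merge (u ∷ []) (normalise p)) (+-cong (+-identityʳ _) (eval-normalise p))

      eval-norm : ∀ e → eval xs (norm e) ≈ ⟦ e ⟧ xs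
      eval-norm (lit p) = eval-normalise p
      eval-norm (e ⊕ f) = trans (eval-merge (norm e) (norm f)) (+-cong (eval-norm e) (eval-norm f))
      eval-norm (e ⊗ f) = trans (eval-multiply (norm e) (norm f)) (*-cong (eval-norm e) (eval-norm f))

      ⟦⟧-cong-norm : ∀ e f → norm e ≡ norm f → ⟦ e ⟧ xs ≈ ⟦ f ⟧ xs
      ⟦⟧-cong-norm e f e≡f = begin
        ⟦ e ⟧ xs          ≈⟨ eval-norm e ⟨
        eval xs (norm e)  ≡⟨ ≡.cong (eval xs) e≡f ⟩
        eval xs (norm f)  ≈⟨ eval-norm f ⟩
        ⟦ f ⟧ xs          ∎

      eval-linearCombination : ∀ {R : Set} (rel : R → Poly n) → (∀ r → eval xs (rel r) ≈ 0#) →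
                               ∀ cs → eval xs (linearCombination rel cs) ≈ 0#
      eval-linearCombination rel rel≈0 []             = refl
      eval-linearCombination rel rel≈0 ((g , r) ∷ cs) = begin
        eval xs (merge (multiply (normalise g) (normalise (rel r))) (linearCombination rel cs))
          ≈⟨ eval-merge (multiply (normalise g) (normalise (rel r))) (linearCombination rel cs) ⟩
        eval xs (multiply (normalise g) (normalise (rel r))) + eval xs (linearCombination rel cs)
          ≈⟨ +-cong (eval-multiply (normalise g) (normalise (rel r))) (eval-linearCombination rel rel≈0 cs) ⟩
        eval xs (normalise g) * eval xs (normalise (rel r)) + 0#
          ≈⟨ +-congʳ (*-congˡ (trans (eval-normalise (rel r)) (rel≈0 r))) ⟩
        eval xs (normalise g) * 0# + 0#
          ≈⟨ trans (+-identityʳ _) (zeroʳ _) ⟩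
        0# ∎

      ⟦⟧≈0 : ∀ {R : Set} (rel : R → Poly n) → (∀ r → eval xs (rel r) ≈ 0#) →
             ∀ e cs → norm e ≡ linearCombination rel cs → ⟦ e ⟧ xs ≈ 0#
      ⟦⟧≈0 rel rel≈0 e cs e≡cs = begin
        ⟦ e ⟧ xs                             ≈⟨ eval-norm e ⟨
        eval xs (norm e)                     ≡⟨ ≡.cong (eval xs) e≡cs ⟩
        eval xs (linearCombination rel cs)   ≈⟨ eval-linearCombination rel rel≈0 cs ⟩
        0#                                   ∎

    module Conjugates (m : ℕ) (q≡2^m : q ≡ 2 ^ m) (c : Carrier) (c^q⁶≈c : pow c (q ^ 6) ≈ c) where
      open BaseQ using (#_; 𝐪; 𝐪^_; value; digits; σ; σ^)
      open Setup K q using (sumPow)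

      conj : Fin 6 → Carrier
      conj i = pow c (q ^ toℕ i)

      conjugates : Vec Carrier 6
      conjugates = Vec.tabulate conj

      pow-q-+ : ∀ x y → pow (x + y) q ≈ pow x q + pow y q
      pow-q-+ x y = ≡.subst (λ n → pow (x + y) n ≈ pow x n + pow y n) (≡.sym q≡2^m) (frobenius m x y)

      pow-q-0# : pow 0# q ≈ 0#
      pow-q-0# = trans (pow-cong q (sym (+-identityʳ 0#))) (trans (pow-q-+ 0# 0#) (x+x≈0 _))

      pow-q^-0# : ∀ k → pow 0# (q ^ k) ≈ 0#
      pow-q^-0# zero    = zeroˡ _
      pow-q^-0# (suc k) = trans (pow-* 0# q (q ^ k)) (trans (pow-cong q (pow-q^-0# k)) pow-q-0#)

      evalMonomial-σ : ∀ u → pow (evalMonomial conjugates u) q ≈ evalMonomial conjugates (σ u)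
      evalMonomial-σ u@(a ∷ b ∷ d ∷ e ∷ f ∷ g ∷ []) = begin
        pow (evalMonomial conjugates u) q
          ≈⟨ pow-evalMonomial-variables conjugates u q ⟩
        pow (pow x₀ q) a * (pow (pow x₁ q) b * (pow (pow x₂ q) d *
          (pow (pow x₃ q) e * (pow (pow x₄ q) f * (pow (pow x₅ q) g * 1#)))))
          ≈⟨ *-cong (pow-cong a (next 0)) (*-cong (pow-cong b (next 1)) (*-cong (pow-cong d (next 2))
               (*-cong (pow-cong e (next 3)) (*-cong (pow-cong f (next 4)) (*-congʳ (pow-cong g x₅^q≈x₀)))))) ⟩
        pow x₁ a * (pow x₂ b * (pow x₃ d * (pow x₄ e * (pow x₅ f * (pow x₀ g * 1#)))))
          ≈⟨ solve 6 (λ y₀ y₁ y₂ y₃ y₄ y₅ → y₁ :* (y₂ :* (y₃ :* (y₄ :* (y₅ :* (y₀ :* con 1)))))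
                                       := y₀ :* (y₁ :* (y₂ :* (y₃ :* (y₄ :* (y₅ :* con 1))))))
               refl (pow x₀ g) (pow x₁ a) (pow x₂ b) (pow x₃ d) (pow x₄ e) (pow x₅ f) ⟩
        evalMonomial conjugates (σ u) ∎
        where
        x₀ x₁ x₂ x₃ x₄ x₅ : Carrier
        x₀ = conj 0F ; x₁ = conj 1F ; x₂ = conj 2F ; x₃ = conj 3F ; x₄ = conj 4F ; x₅ = conj 5F
        next : ∀ i → pow (pow c (q ^ i)) q ≈ pow c (q ^ suc i)
        next i = sym (pow-* c q (q ^ i))
        x₅^q≈x₀ : pow x₅ q ≈ x₀
        x₅^q≈x₀ = trans (next 5) (trans c^q⁶≈c (sym (*-identityʳ c)))

      eval-σ : ∀ p → pow (eval conjugates p) q ≈ eval conjugates (List.map σ p)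
      eval-σ []      = pow-q-0#
      eval-σ (u ∷ p) = trans (pow-q-+ _ _) (+-cong (evalMonomial-σ u) (eval-σ p))

      eval-σ^ : ∀ k p → pow (eval conjugates p) (q ^ k) ≈ eval conjugates (σ^ k p)
      eval-σ^ zero    p = *-identityʳ _
      eval-σ^ (suc k) p = trans (pow-* _ q (q ^ k)) (trans (pow-cong q (eval-σ^ k p)) (eval-σ (σ^ k p)))

      eval-σ^-≈0 : ∀ k {p} → eval conjugates p ≈ 0# → eval conjugates (σ^ k p) ≈ 0#
      eval-σ^-≈0 k {p} p≈0 = trans (sym (eval-σ^ k p)) (trans (pow-cong (q ^ k) p≈0) (pow-q^-0# k))

      pow-value : ∀ e → pow c (value q e) ≈ evalMonomial conjugates (digits e)
      pow-value (# n)   = begin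
        pow c n                                          ≈⟨ pow-cong n (*-identityʳ c) ⟨
        pow (conj 0F) n                                  ≈⟨ *-identityʳ _ ⟨
        pow (conj 0F) n * 1#                             ≈⟨ *-congˡ (evalMonomial-0 (Vec.tail conjugates)) ⟨
        evalMonomial conjugates (n ∷ Vec.replicate 5 0)  ∎
      pow-value 𝐪       = begin
        pow c q                                  ≡⟨ ≡.cong (pow c) (ℕ.*-identityʳ q) ⟨
        conj 1F                                  ≈⟨ evalMonomial-unit conjugates 1F ⟨
        evalMonomial conjugates (digits 𝐪)       ∎
      pow-value (𝐪^ i)  = begin
        conj i                                   ≡⟨ Vec.lookup∘tabulate conj i ⟨
        Vec.lookup conjugates i                  ≈⟨ evalMonomial-unit conjugates i ⟨
        evalMonomial conjugates (digits (𝐪^ i))  ∎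
      pow-value (e BaseQ.+ f) = begin
        pow c (value q e ℕ.+ value q f)
          ≈⟨ pow-+ c (value q e) (value q f) ⟩
        pow c (value q e) * pow c (value q f)
          ≈⟨ *-cong (pow-value e) (pow-value f) ⟩
        evalMonomial conjugates (digits e) * evalMonomial conjugates (digits f)
          ≈⟨ evalMonomial-·ₘ conjugates (digits e) (digits f) ⟨
        evalMonomial conjugates (digits e ·ₘ digits f) ∎
      pow-value (k BaseQ.· e) = begin
        pow c (k ℕ.* value q e)                      ≈⟨ pow-* c k (value q e) ⟩
        pow (pow c (value q e)) k                    ≈⟨ pow-cong k (pow-value e) ⟩
        pow (evalMonomial conjugates (digits e)) k   ≈⟨ pow-evalMonomial-exponents conjugates (digits e) k ⟩
        evalMonomial conjugates (Vec.map (k ℕ.*_) (digits e)) ∎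

      sumPow-value : ∀ es → sumPow c (List.map (value q) es) ≈ eval conjugates (List.map digits es)
      sumPow-value []       = refl
      sumPow-value (e ∷ es) = +-cong (pow-value e) (sumPow-value es)


module Relations where
  open import Data.Product using (_×_)
  open 𝔽₂Poly
  open BaseQ

  -- These lists copy the exponents of Defs term for term, so that for instance
  -- F₁ c is definitionally sumPow c (List.map (value q) eF₁).
  eF₁ eF₂ eF₃ eA₁ eA₂ eA₃ eA₄ eH : List Exponent
  eF₁ = 𝐪^ 4F + 2 · 𝐪^ 3F + 𝐪^ 2F + 𝐪 + # 1 ∷ 𝐪^ 4F + 𝐪^ 3F + 𝐪^ 2F + # 1 ∷ 𝐪^ 3F + 𝐪 + # 1 ∷ # 1
      ∷ 2 · 𝐪^ 3F + 𝐪^ 2F + 𝐪 ∷ 𝐪^ 3F + 𝐪^ 2F + 𝐪 ∷ 𝐪^ 3F ∷ # 0 ∷ []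
  eF₂ = 𝐪^ 3F + 𝐪^ 2F + 2 · 𝐪 + # 2 ∷ 𝐪^ 2F + 𝐪 + # 2 ∷ 𝐪^ 3F + 2 · 𝐪^ 2F + 2 · 𝐪 + # 1
      ∷ 2 · 𝐪^ 3F + 2 · 𝐪^ 2F + 𝐪 + # 1 ∷ 𝐪^ 2F + 𝐪 + # 1 ∷ 𝐪^ 3F + 𝐪 + # 1
      ∷ 𝐪^ 3F + 𝐪^ 2F + # 1 ∷ # 1 ∷ 2 · 𝐪^ 3F + 𝐪^ 2F + 𝐪 ∷ 𝐪^ 3F + 𝐪^ 2F + 𝐪 ∷ 𝐪^ 3F ∷ # 0 ∷ []
  eF₃ = 𝐪^ 2F + 𝐪 + # 1 ∷ # 0 ∷ []
  eA₁ = 𝐪^ 5F + 𝐪^ 4F + 𝐪^ 3F + 𝐪^ 2F + 2 · 𝐪 + # 1 ∷ 𝐪^ 5F + 𝐪^ 3F + 𝐪^ 2F + 2 · 𝐪 + # 1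
      ∷ 𝐪^ 2F + 2 · 𝐪 + # 1 ∷ 2 · 𝐪 + # 1 ∷ 𝐪^ 4F + 𝐪^ 3F + 𝐪^ 2F + 𝐪 + # 1
      ∷ 𝐪^ 3F + 𝐪^ 2F + 𝐪 + # 1 ∷ 𝐪^ 5F + 𝐪^ 4F + 𝐪^ 2F + 𝐪 + # 1 ∷ 𝐪^ 5F + 𝐪^ 2F + 𝐪 + # 1
      ∷ 𝐪^ 4F + 𝐪^ 2F + # 1 ∷ # 1 ∷ 𝐪^ 2F + 2 · 𝐪 ∷ 𝐪^ 5F + 𝐪^ 4F + 𝐪^ 3F + 2 · 𝐪
      ∷ 𝐪^ 5F + 𝐪^ 3F + 2 · 𝐪 ∷ 2 · 𝐪 ∷ 𝐪^ 4F + 𝐪^ 3F + 𝐪 ∷ 𝐪^ 3F + 𝐪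
      ∷ 𝐪^ 5F + 𝐪^ 4F + 𝐪 ∷ 𝐪^ 5F + 𝐪 ∷ 𝐪^ 2F ∷ 𝐪^ 4F ∷ []
  eA₂ = 𝐪^ 5F + 𝐪^ 4F + 𝐪^ 3F + 𝐪^ 2F + 𝐪 + # 1 ∷ 𝐪 + # 1 ∷ 𝐪^ 4F + 𝐪^ 2F + # 1 ∷ 𝐪^ 5F + # 1
      ∷ 𝐪^ 2F + 𝐪 ∷ 𝐪^ 5F + 𝐪^ 3F + 𝐪 ∷ 𝐪^ 3F + 𝐪^ 2F ∷ 𝐪^ 4F + 𝐪^ 3F ∷ 𝐪^ 5F + 𝐪^ 4F ∷ # 0 ∷ []
  eA₃ = 𝐪^ 5F + 𝐪^ 4F + 𝐪 + # 1 ∷ 𝐪^ 5F + 𝐪 + # 1 ∷ 𝐪 + # 1 ∷ 𝐪^ 4F + # 1 ∷ 𝐪 ∷ # 0 ∷ []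
  eA₄ = 𝐪^ 5F + 𝐪^ 4F + 𝐪^ 3F + 𝐪^ 2F ∷ 𝐪^ 4F + 𝐪^ 3F + 𝐪^ 2F ∷ 𝐪^ 3F + 𝐪^ 2F ∷ 𝐪^ 2F
      ∷ 𝐪^ 5F + 𝐪^ 3F ∷ # 0 ∷ []
  eH  = 𝐪^ 3F ∷ 𝐪^ 3F + 𝐪^ 4F ∷ 𝐪 ∷ 𝐪 + 2 · 𝐪^ 3F + 𝐪^ 4F ∷ 𝐪 + 𝐪^ 2F + 2 · 𝐪^ 3F
      ∷ 2 · 𝐪 + 𝐪^ 2F + 𝐪^ 3F ∷ # 1 + 𝐪 ∷ # 1 + 2 · 𝐪 + 𝐪^ 3F ∷ []

  f₁ f₂ f₃ a₁ a₂ a₃ a₄ h : Poly 6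
  f₁ = List.map digits eF₁
  f₂ = List.map digits eF₂
  f₃ = List.map digits eF₃
  a₁ = List.map digits eA₁
  a₂ = List.map digits eA₂
  a₃ = List.map digits eA₃
  a₄ = List.map digits eA₄
  h  = List.map digits eH

  c^[1+q²] : Poly 6
  c^[1+q²] = digits (# 1 + 𝐪^ 2F) ∷ []

  F₁+F₂≡c^[1+q²]*H : norm (lit f₁ ⊕ lit f₂) ≡ norm (lit c^[1+q²] ⊗ lit h)
  F₁+F₂≡c^[1+q²]*H = ≡.refl

  data Relation : Set where
    σF₁ σH : ℕ → Relation

  relation : Relation → Poly 6
  relation (σF₁ k) = σ^ k f₁
  relation (σH  k) = σ^ k h

  Certificate : Set
  Certificate = List (Poly 6 × Relation)

  x^ : ℕ → ℕ → ℕ → ℕ → ℕ → ℕ → Monomial 6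
  x^ a b c d e f = a ∷ b ∷ c ∷ d ∷ e ∷ f ∷ []

  -- The polynomials representing α = F₃(c)^(q³) and α^q = F₃(c)^(q⁴).
  α̂ α̂^q : Expr 6
  α̂   = lit (σ^ 3 f₃)
  α̂^q = lit (σ^ 4 f₃)

  A₃A₄+A₁α A₃A₄+A₁^qα^q A₃α²+A₄α^q²+A₂αα^q : Expr 6
  A₃A₄+A₁α            = lit a₃ ⊗ lit a₄ ⊕ lit a₁ ⊗ α̂
  A₃A₄+A₁^qα^q        = lit a₃ ⊗ lit a₄ ⊕ lit (σ^ 1 a₁) ⊗ α̂^q
  A₃α²+A₄α^q²+A₂αα^q = lit a₃ ⊗ (α̂ ⊗ α̂) ⊕ lit a₄ ⊗ (α̂^q ⊗ α̂^q) ⊕ lit a₂ ⊗ (α̂ ⊗ α̂^q)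

  certificate-A₃A₄+A₁α : Certificate
  certificate-A₃A₄+A₁α =
      (x^ 0 0 0 0 0 0 ∷ x^ 0 0 0 0 0 2 ∷ x^ 0 0 0 0 1 0 ∷ x^ 0 0 0 0 1 1 ∷ x^ 0 0 0 0 1 2 ∷
       x^ 0 0 1 0 1 0 ∷ x^ 0 0 1 0 1 1 ∷ x^ 0 0 1 1 1 1 ∷ x^ 0 0 1 1 2 1 ∷ x^ 0 1 0 0 0 2 ∷
       x^ 0 1 0 0 1 0 ∷ x^ 0 1 0 0 2 0 ∷ x^ 0 1 1 0 0 0 ∷ x^ 0 1 1 0 0 1 ∷ x^ 1 0 0 0 0 1 ∷
       x^ 1 0 0 0 0 2 ∷ x^ 1 0 0 0 2 0 ∷ x^ 1 0 0 0 2 2 ∷ x^ 1 0 1 0 1 0 ∷ x^ 1 0 1 0 1 2 ∷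
       x^ 1 0 1 0 2 1 ∷ x^ 1 0 1 1 1 1 ∷ x^ 1 0 1 1 2 1 ∷ x^ 1 1 0 0 0 1 ∷ x^ 1 1 0 0 1 0 ∷
       x^ 1 1 0 0 1 1 ∷ x^ 1 1 0 0 1 2 ∷ x^ 1 1 0 0 2 1 ∷ x^ 1 1 0 0 2 2 ∷ x^ 1 1 0 1 1 2 ∷
       x^ 1 1 1 0 0 1 ∷ x^ 1 1 1 0 1 0 ∷ x^ 1 1 1 0 2 1 ∷ x^ 1 1 1 0 2 2 ∷ x^ 1 1 1 1 1 2 ∷
       x^ 1 2 0 0 0 2 ∷ x^ 1 2 0 0 1 1 ∷ x^ 1 2 0 0 2 1 ∷ x^ 1 2 1 0 0 1 ∷ x^ 2 0 0 0 1 1 ∷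
       x^ 2 0 0 0 2 1 ∷ x^ 2 0 0 0 2 2 ∷ x^ 2 0 1 0 1 2 ∷ x^ 2 1 0 0 2 1 ∷ x^ 2 1 1 0 1 1 ∷
       x^ 2 1 1 0 1 2 ∷ x^ 2 2 0 0 1 1 ∷ x^ 2 2 0 0 2 2 ∷ x^ 2 2 1 0 1 1 ∷ x^ 2 2 1 0 2 2 ∷ [] , σF₁ 0)
    ∷ (x^ 0 0 0 0 0 2 ∷ x^ 0 0 0 0 1 0 ∷ x^ 0 0 0 1 0 0 ∷ x^ 0 0 1 1 0 0 ∷ x^ 0 0 1 2 0 0 ∷
       x^ 0 1 0 0 0 0 ∷ x^ 1 0 0 0 1 1 ∷ x^ 1 0 0 1 0 0 ∷ x^ 1 0 0 1 0 1 ∷ x^ 1 0 0 1 0 2 ∷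
       x^ 1 0 0 1 1 0 ∷ x^ 1 0 0 1 1 1 ∷ x^ 1 0 0 1 1 2 ∷ x^ 1 0 1 0 0 1 ∷ x^ 1 0 1 1 0 0 ∷
       x^ 1 0 1 1 0 1 ∷ x^ 1 0 1 2 1 0 ∷ x^ 1 1 0 0 0 1 ∷ x^ 1 1 0 0 0 2 ∷ x^ 1 1 0 0 1 0 ∷
       x^ 1 1 0 1 1 1 ∷ x^ 1 1 0 1 1 2 ∷ x^ 1 1 1 0 0 1 ∷ x^ 1 1 1 0 0 2 ∷ x^ 1 1 1 0 1 0 ∷
       x^ 1 2 0 0 0 1 ∷ x^ 1 2 0 1 0 1 ∷ x^ 2 0 0 0 0 0 ∷ x^ 2 0 0 0 0 1 ∷ x^ 2 0 0 0 0 2 ∷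
       x^ 2 0 0 0 1 0 ∷ x^ 2 0 0 0 1 1 ∷ x^ 2 0 0 1 1 0 ∷ x^ 2 0 0 1 1 1 ∷ x^ 2 0 1 0 0 1 ∷
       x^ 2 0 1 0 1 0 ∷ x^ 2 0 1 0 1 1 ∷ x^ 2 0 1 1 1 1 ∷ x^ 2 1 0 0 0 0 ∷ x^ 2 1 0 0 0 1 ∷
       x^ 2 1 0 0 0 2 ∷ x^ 2 1 0 0 1 1 ∷ x^ 2 1 0 1 0 2 ∷ x^ 2 1 0 1 1 1 ∷ x^ 2 1 1 0 0 0 ∷
       x^ 2 1 1 0 0 1 ∷ x^ 2 1 1 0 0 2 ∷ x^ 2 1 1 0 1 1 ∷ x^ 2 1 1 1 0 2 ∷ x^ 2 1 1 1 1 1 ∷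
       x^ 2 2 0 0 0 1 ∷ x^ 2 2 0 1 0 1 ∷ x^ 2 2 0 1 0 2 ∷ x^ 2 2 1 0 0 1 ∷ [] , σF₁ 1)
    ∷ (x^ 0 0 0 0 1 0 ∷ x^ 0 0 0 1 0 0 ∷ x^ 0 0 0 1 2 0 ∷ x^ 0 1 0 0 0 0 ∷ x^ 0 1 0 0 0 1 ∷
       x^ 0 1 0 0 1 0 ∷ x^ 0 1 0 0 1 1 ∷ x^ 0 1 0 1 0 0 ∷ x^ 0 1 0 1 1 0 ∷ x^ 0 1 0 1 1 1 ∷
       x^ 0 1 0 1 2 1 ∷ x^ 0 2 0 0 1 0 ∷ x^ 0 2 0 1 0 0 ∷ x^ 0 2 0 1 0 1 ∷ x^ 0 2 1 0 0 0 ∷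
       x^ 0 2 1 1 0 0 ∷ x^ 1 0 1 0 2 0 ∷ x^ 1 1 1 0 1 0 ∷ x^ 1 1 1 1 0 0 ∷ x^ 1 1 1 1 1 0 ∷
       x^ 1 1 1 1 2 0 ∷ x^ 1 2 0 0 0 1 ∷ x^ 1 2 0 1 0 0 ∷ x^ 1 2 0 1 0 1 ∷ x^ 1 2 1 0 1 1 ∷
       x^ 1 2 1 1 0 0 ∷ x^ 1 2 1 1 1 0 ∷ x^ 1 2 1 1 1 1 ∷ x^ 2 0 0 0 1 0 ∷ x^ 2 0 1 0 2 0 ∷
       x^ 2 1 0 1 1 0 ∷ x^ 2 1 1 0 1 0 ∷ x^ 2 1 1 1 2 0 ∷ x^ 2 2 1 1 1 0 ∷ [] , σF₁ 2)
    ∷ (x^ 0 0 0 0 0 1 ∷ x^ 0 0 0 0 1 0 ∷ x^ 0 0 0 0 1 1 ∷ x^ 0 0 1 0 0 1 ∷ x^ 0 0 1 1 0 0 ∷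
       x^ 0 0 1 1 0 1 ∷ x^ 0 0 1 1 2 0 ∷ x^ 0 0 1 1 2 1 ∷ x^ 0 0 2 2 1 0 ∷ x^ 0 0 2 2 2 0 ∷
       x^ 0 1 0 0 0 0 ∷ x^ 0 1 0 0 1 1 ∷ x^ 0 1 0 1 0 1 ∷ x^ 0 1 0 1 0 2 ∷ x^ 0 1 0 1 1 1 ∷
       x^ 0 1 1 0 0 1 ∷ x^ 0 1 1 0 1 0 ∷ x^ 0 1 1 0 1 1 ∷ x^ 0 1 1 1 0 1 ∷ x^ 0 1 1 1 1 0 ∷
       x^ 0 1 1 1 1 2 ∷ x^ 0 1 1 2 1 1 ∷ x^ 0 1 2 1 1 1 ∷ x^ 0 1 2 2 1 1 ∷ x^ 0 2 0 0 0 0 ∷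
       x^ 0 2 0 0 1 0 ∷ x^ 0 2 0 1 0 1 ∷ x^ 0 2 0 1 0 2 ∷ x^ 0 2 1 0 0 1 ∷ x^ 0 2 1 1 0 1 ∷
       x^ 0 2 1 1 1 0 ∷ x^ 0 2 1 1 1 1 ∷ x^ 0 2 1 1 1 2 ∷ x^ 0 2 1 1 2 0 ∷ x^ 0 2 2 0 0 0 ∷
       x^ 0 2 2 1 0 0 ∷ x^ 1 0 0 0 0 0 ∷ x^ 1 0 0 0 1 0 ∷ x^ 1 0 0 0 1 1 ∷ x^ 1 0 1 0 0 1 ∷
       x^ 1 0 1 0 1 0 ∷ x^ 1 0 1 1 1 0 ∷ x^ 1 0 1 1 1 1 ∷ x^ 1 0 1 1 2 0 ∷ x^ 1 0 1 1 2 1 ∷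
       x^ 1 0 2 0 2 0 ∷ x^ 1 0 2 1 1 1 ∷ x^ 1 0 2 1 2 1 ∷ x^ 1 1 0 0 1 0 ∷ x^ 1 1 1 0 0 0 ∷
       x^ 1 1 1 0 0 1 ∷ x^ 1 1 1 1 2 0 ∷ x^ 1 1 2 0 1 0 ∷ x^ 1 1 2 1 1 0 ∷ x^ 1 2 0 0 0 0 ∷
       x^ 1 2 0 0 1 1 ∷ x^ 1 2 1 0 0 0 ∷ x^ 1 2 1 0 1 1 ∷ x^ 1 2 1 1 1 0 ∷ x^ 1 2 1 1 2 1 ∷
       x^ 1 2 2 1 1 0 ∷ x^ 1 2 2 1 2 1 ∷ [] , σF₁ 3)
    ∷ (x^ 0 0 0 0 0 1 ∷ x^ 0 0 0 0 1 0 ∷ x^ 0 0 0 1 0 1 ∷ x^ 0 0 0 1 1 2 ∷ x^ 0 0 0 2 1 1 ∷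
       x^ 0 0 0 2 1 2 ∷ x^ 0 0 0 2 2 1 ∷ x^ 0 0 0 2 2 2 ∷ x^ 0 0 1 0 0 1 ∷ x^ 0 0 1 1 0 0 ∷
       x^ 0 0 1 1 1 0 ∷ x^ 0 0 1 1 1 2 ∷ x^ 0 0 1 1 2 0 ∷ x^ 0 0 1 2 1 1 ∷ x^ 0 1 0 0 0 0 ∷
       x^ 0 1 0 1 1 0 ∷ x^ 0 1 0 1 1 1 ∷ x^ 0 1 0 2 0 1 ∷ x^ 0 1 0 2 0 2 ∷ x^ 0 1 0 2 1 1 ∷
       x^ 1 0 0 0 0 0 ∷ x^ 1 0 0 0 1 0 ∷ x^ 1 0 0 1 1 0 ∷ x^ 1 0 1 0 0 1 ∷ x^ 1 0 1 0 1 0 ∷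
       x^ 1 0 1 0 1 1 ∷ x^ 1 1 0 0 0 0 ∷ x^ 1 1 1 0 0 0 ∷ [] , σF₁ 4)
    ∷ (x^ 0 0 0 1 0 0 ∷ x^ 0 0 0 1 1 0 ∷ x^ 0 0 0 1 1 1 ∷ x^ 0 0 0 1 2 0 ∷ x^ 0 1 0 0 0 0 ∷
       x^ 0 1 0 0 2 0 ∷ [] , σF₁ 5)
    ∷ (x^ 0 0 0 0 0 1 ∷ x^ 0 0 0 0 0 2 ∷ [] , σH 0)
    ∷ []

  certificate-A₃A₄+A₁^qα^q : Certificate
  certificate-A₃A₄+A₁^qα^q =
      (x^ 0 0 0 0 0 1 ∷ x^ 0 0 0 0 0 2 ∷ x^ 0 0 0 0 1 1 ∷ x^ 0 0 0 0 2 0 ∷ x^ 0 0 0 0 2 1 ∷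
       x^ 0 0 0 1 1 1 ∷ x^ 0 0 0 1 2 1 ∷ x^ 0 0 1 0 1 0 ∷ x^ 0 0 1 0 1 1 ∷ x^ 0 0 1 0 1 2 ∷
       x^ 0 0 1 0 2 0 ∷ x^ 0 1 0 0 1 0 ∷ x^ 0 1 0 0 2 1 ∷ x^ 0 1 1 0 0 0 ∷ x^ 0 1 1 0 0 1 ∷
       x^ 0 1 1 0 1 2 ∷ x^ 0 1 1 0 2 1 ∷ x^ 0 1 1 0 2 2 ∷ x^ 1 0 0 0 0 1 ∷ x^ 1 0 0 0 0 2 ∷
       x^ 1 0 0 0 1 1 ∷ x^ 1 0 0 0 2 0 ∷ x^ 1 0 0 0 2 1 ∷ x^ 1 0 0 0 2 2 ∷ x^ 1 0 1 0 1 0 ∷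
       x^ 1 0 1 0 1 1 ∷ x^ 1 0 1 0 1 2 ∷ x^ 1 1 0 0 0 1 ∷ x^ 1 1 0 0 1 0 ∷ x^ 1 1 0 0 2 2 ∷
       x^ 1 1 0 1 1 2 ∷ x^ 1 1 0 1 2 2 ∷ x^ 1 1 1 0 0 1 ∷ x^ 1 1 1 0 1 0 ∷ x^ 1 1 1 0 1 1 ∷
       x^ 1 1 1 0 1 2 ∷ x^ 1 1 1 0 2 2 ∷ x^ 1 2 0 0 0 2 ∷ x^ 1 2 0 0 1 1 ∷ x^ 1 2 0 0 2 2 ∷
       x^ 1 2 1 0 0 1 ∷ x^ 1 2 1 0 2 2 ∷ x^ 2 0 0 0 1 1 ∷ x^ 2 0 0 0 2 1 ∷ x^ 2 0 0 0 2 2 ∷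
       x^ 2 0 1 0 1 2 ∷ x^ 2 1 0 0 2 1 ∷ x^ 2 1 1 0 1 1 ∷ x^ 2 1 1 0 1 2 ∷ x^ 2 2 0 0 1 1 ∷
       x^ 2 2 0 0 2 2 ∷ x^ 2 2 1 0 1 1 ∷ x^ 2 2 1 0 2 2 ∷ [] , σF₁ 0)
    ∷ (x^ 0 0 0 0 0 1 ∷ x^ 0 0 0 0 1 2 ∷ x^ 0 0 0 1 0 0 ∷ x^ 0 0 0 1 0 2 ∷ x^ 0 0 0 2 0 0 ∷
       x^ 0 0 1 0 1 2 ∷ x^ 0 0 1 1 0 0 ∷ x^ 0 1 0 0 0 0 ∷ x^ 0 1 0 0 0 1 ∷ x^ 0 1 0 0 0 2 ∷
       x^ 0 1 0 1 0 0 ∷ x^ 0 1 0 1 0 1 ∷ x^ 0 1 0 1 0 2 ∷ x^ 0 1 1 0 0 0 ∷ x^ 0 1 1 0 0 1 ∷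
       x^ 0 1 1 1 0 0 ∷ x^ 0 1 1 1 0 1 ∷ x^ 1 0 0 0 1 0 ∷ x^ 1 0 0 1 0 1 ∷ x^ 1 0 0 1 0 2 ∷
       x^ 1 0 0 1 1 1 ∷ x^ 1 0 0 2 1 0 ∷ x^ 1 0 1 0 0 2 ∷ x^ 1 0 1 0 1 0 ∷ x^ 1 0 1 1 0 2 ∷
       x^ 1 0 1 1 1 0 ∷ x^ 1 1 0 1 0 2 ∷ x^ 1 1 0 1 1 0 ∷ x^ 1 1 0 2 0 1 ∷ x^ 1 1 1 0 0 0 ∷
       x^ 1 1 1 0 0 1 ∷ x^ 1 1 1 0 0 2 ∷ x^ 1 1 1 0 1 2 ∷ x^ 1 1 1 1 0 2 ∷ x^ 1 1 1 1 1 0 ∷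
       x^ 1 1 1 1 1 1 ∷ x^ 1 1 2 0 0 0 ∷ x^ 1 1 2 0 1 2 ∷ x^ 1 2 0 0 0 1 ∷ x^ 1 2 0 1 0 2 ∷
       x^ 1 2 1 0 0 1 ∷ x^ 1 2 1 1 0 1 ∷ x^ 2 0 0 0 0 0 ∷ x^ 2 0 0 0 0 1 ∷ x^ 2 0 0 0 0 2 ∷
       x^ 2 0 0 0 1 0 ∷ x^ 2 0 0 0 1 1 ∷ x^ 2 0 0 1 1 0 ∷ x^ 2 0 1 0 0 1 ∷ x^ 2 0 1 0 1 0 ∷
       x^ 2 0 1 0 1 1 ∷ x^ 2 0 1 1 1 1 ∷ x^ 2 1 0 0 0 0 ∷ x^ 2 1 0 0 0 1 ∷ x^ 2 1 0 0 0 2 ∷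
       x^ 2 1 0 1 0 2 ∷ x^ 2 1 0 1 1 1 ∷ x^ 2 1 0 2 1 1 ∷ x^ 2 1 1 0 0 0 ∷ x^ 2 1 1 0 0 1 ∷
       x^ 2 1 1 1 0 2 ∷ x^ 2 1 1 1 1 1 ∷ x^ 2 1 2 0 0 2 ∷ x^ 2 1 2 0 1 1 ∷ x^ 2 2 0 0 0 1 ∷
       x^ 2 2 0 1 0 1 ∷ x^ 2 2 0 1 0 2 ∷ x^ 2 2 0 1 1 1 ∷ x^ 2 2 1 0 0 1 ∷ x^ 2 2 1 1 1 1 ∷ [] , σF₁ 1)
    ∷ (x^ 0 0 0 0 0 0 ∷ x^ 0 0 0 1 0 0 ∷ x^ 0 0 0 1 1 0 ∷ x^ 0 0 1 0 1 0 ∷ x^ 0 0 1 1 0 0 ∷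
       x^ 0 0 1 1 1 0 ∷ x^ 0 1 0 1 0 0 ∷ x^ 0 1 0 1 0 1 ∷ x^ 0 1 0 1 1 0 ∷ x^ 0 1 0 1 1 1 ∷
       x^ 0 1 1 1 1 1 ∷ x^ 0 2 0 0 0 1 ∷ x^ 0 2 0 1 0 0 ∷ x^ 0 2 0 1 1 1 ∷ x^ 0 2 1 0 0 0 ∷
       x^ 0 2 1 0 1 1 ∷ x^ 0 2 1 1 0 0 ∷ x^ 0 2 1 1 1 1 ∷ x^ 1 0 0 0 0 0 ∷ x^ 1 0 0 0 1 0 ∷
       x^ 1 0 1 0 0 0 ∷ x^ 1 0 1 0 1 0 ∷ x^ 1 0 1 0 2 0 ∷ x^ 1 1 0 1 0 0 ∷ x^ 1 1 0 1 1 0 ∷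
       x^ 1 1 1 0 1 0 ∷ x^ 1 1 1 1 2 0 ∷ x^ 1 1 2 0 0 0 ∷ x^ 1 1 2 0 1 0 ∷ x^ 1 2 0 1 0 0 ∷
       x^ 1 2 0 1 0 1 ∷ x^ 1 2 1 0 0 0 ∷ x^ 1 2 1 0 0 1 ∷ x^ 1 2 1 1 0 0 ∷ x^ 1 2 1 1 1 0 ∷
       x^ 1 2 1 1 1 1 ∷ x^ 1 2 2 0 1 0 ∷ x^ 1 2 2 0 1 1 ∷ x^ 2 0 0 0 1 0 ∷ x^ 2 0 1 0 2 0 ∷
       x^ 2 1 0 1 1 0 ∷ x^ 2 1 1 0 1 0 ∷ x^ 2 1 1 1 2 0 ∷ x^ 2 2 1 1 1 0 ∷ [] , σF₁ 2)
    ∷ (x^ 0 0 0 0 0 0 ∷ x^ 0 0 0 0 0 1 ∷ x^ 0 0 0 0 1 1 ∷ x^ 0 0 0 1 0 0 ∷ x^ 0 0 0 1 1 0 ∷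
       x^ 0 0 1 0 0 0 ∷ x^ 0 0 1 1 1 1 ∷ x^ 0 0 1 1 2 1 ∷ x^ 0 0 1 2 1 0 ∷ x^ 0 0 1 2 2 0 ∷
       x^ 0 0 2 0 0 0 ∷ x^ 0 0 2 0 1 1 ∷ x^ 0 0 2 1 0 1 ∷ x^ 0 0 2 1 1 0 ∷ x^ 0 0 2 1 1 1 ∷
       x^ 0 0 2 1 2 0 ∷ x^ 0 1 0 0 0 0 ∷ x^ 0 1 0 0 0 1 ∷ x^ 0 1 0 0 1 1 ∷ x^ 0 1 0 1 0 0 ∷
       x^ 0 1 0 1 0 1 ∷ x^ 0 1 0 1 0 2 ∷ x^ 0 1 0 2 1 1 ∷ x^ 0 1 1 0 1 0 ∷ x^ 0 1 1 0 1 1 ∷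
       x^ 0 1 1 1 1 1 ∷ x^ 0 1 1 1 1 2 ∷ x^ 0 1 1 2 1 1 ∷ x^ 0 2 0 0 1 1 ∷ x^ 0 2 0 1 0 1 ∷
       x^ 0 2 0 1 0 2 ∷ x^ 0 2 0 1 1 1 ∷ x^ 0 2 1 0 0 0 ∷ x^ 0 2 1 0 0 1 ∷ x^ 0 2 1 0 1 0 ∷
       x^ 0 2 1 0 1 1 ∷ x^ 0 2 1 1 0 1 ∷ x^ 0 2 1 1 1 0 ∷ x^ 0 2 1 1 1 2 ∷ x^ 0 2 2 0 0 0 ∷
       x^ 0 2 2 0 1 0 ∷ x^ 0 2 2 1 0 0 ∷ x^ 1 0 0 0 0 0 ∷ x^ 1 0 0 0 1 0 ∷ x^ 1 0 0 0 1 1 ∷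
       x^ 1 0 1 0 0 1 ∷ x^ 1 0 1 0 1 0 ∷ x^ 1 0 1 1 1 0 ∷ x^ 1 0 1 1 1 1 ∷ x^ 1 0 1 1 2 0 ∷
       x^ 1 0 1 1 2 1 ∷ x^ 1 0 2 0 2 0 ∷ x^ 1 0 2 1 1 1 ∷ x^ 1 0 2 1 2 1 ∷ x^ 1 1 0 0 1 0 ∷
       x^ 1 1 1 0 0 0 ∷ x^ 1 1 1 0 0 1 ∷ x^ 1 1 1 1 2 0 ∷ x^ 1 1 2 0 1 0 ∷ x^ 1 1 2 1 1 0 ∷
       x^ 1 2 0 0 0 0 ∷ x^ 1 2 0 0 1 1 ∷ x^ 1 2 1 0 0 0 ∷ x^ 1 2 1 0 1 1 ∷ x^ 1 2 1 1 1 0 ∷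
       x^ 1 2 1 1 2 1 ∷ x^ 1 2 2 1 1 0 ∷ x^ 1 2 2 1 2 1 ∷ [] , σF₁ 3)
    ∷ (x^ 0 0 0 0 0 1 ∷ x^ 0 0 0 0 1 0 ∷ x^ 0 0 0 1 0 0 ∷ x^ 0 0 0 1 1 0 ∷ x^ 0 0 0 1 1 2 ∷
       x^ 0 0 0 2 1 2 ∷ x^ 0 0 1 0 0 0 ∷ x^ 0 0 1 0 1 0 ∷ x^ 0 0 1 1 0 0 ∷ x^ 0 0 1 1 0 1 ∷
       x^ 0 0 1 1 1 0 ∷ x^ 0 0 1 1 1 1 ∷ x^ 0 0 1 1 1 2 ∷ x^ 0 0 1 1 2 2 ∷ x^ 0 0 1 2 0 1 ∷
       x^ 0 0 2 0 0 0 ∷ x^ 0 0 2 0 1 1 ∷ x^ 0 0 2 1 0 0 ∷ x^ 0 0 2 1 0 1 ∷ x^ 0 0 2 1 1 0 ∷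
       x^ 0 0 2 1 2 2 ∷ x^ 0 1 0 0 0 0 ∷ x^ 0 1 0 1 0 1 ∷ x^ 0 1 0 2 0 1 ∷ x^ 0 1 0 2 0 2 ∷
       x^ 0 1 0 2 1 1 ∷ x^ 0 1 0 2 1 2 ∷ x^ 0 1 1 0 0 0 ∷ x^ 1 0 0 0 0 0 ∷ x^ 1 0 0 0 1 0 ∷
       x^ 1 0 0 1 1 0 ∷ x^ 1 0 1 0 1 0 ∷ x^ 1 0 2 0 0 1 ∷ x^ 1 0 2 0 1 1 ∷ x^ 1 0 2 1 1 1 ∷
       x^ 1 0 2 1 2 1 ∷ x^ 1 1 0 0 0 0 ∷ x^ 1 1 1 0 0 0 ∷ [] , σF₁ 4)
    ∷ (x^ 0 0 0 0 0 0 ∷ x^ 0 0 0 0 0 1 ∷ x^ 0 0 0 0 1 0 ∷ x^ 0 0 0 0 1 1 ∷ x^ 0 0 0 0 2 1 ∷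
       x^ 0 0 0 1 0 1 ∷ x^ 0 0 0 1 1 0 ∷ x^ 0 0 0 1 1 1 ∷ x^ 0 0 1 0 0 0 ∷ x^ 0 0 1 0 2 1 ∷
       x^ 0 1 0 0 0 0 ∷ [] , σF₁ 5)
    ∷ (x^ 0 0 0 0 0 1 ∷ x^ 0 0 0 0 0 2 ∷ x^ 0 0 0 0 1 2 ∷ [] , σH 0)
    ∷ []

  certificate-A₃α²+A₄α^q²+A₂αα^q : Certificate
  certificate-A₃α²+A₄α^q²+A₂αα^q =
      (x^ 0 0 0 0 0 1 ∷ x^ 0 0 0 0 0 2 ∷ x^ 0 0 0 0 1 1 ∷ x^ 0 0 0 0 1 2 ∷ x^ 0 0 0 0 2 0 ∷
       x^ 0 0 0 0 2 2 ∷ x^ 0 0 0 1 0 0 ∷ x^ 0 0 0 1 0 1 ∷ x^ 0 0 0 1 1 0 ∷ x^ 0 0 0 1 1 1 ∷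
       x^ 0 0 1 0 1 0 ∷ x^ 0 0 1 0 1 1 ∷ x^ 0 0 1 0 2 0 ∷ x^ 0 0 1 1 1 1 ∷ x^ 0 0 1 1 2 1 ∷
       x^ 0 1 0 0 0 0 ∷ x^ 0 1 0 0 1 0 ∷ x^ 0 1 0 0 1 1 ∷ x^ 0 1 0 0 2 1 ∷ x^ 0 1 0 0 2 2 ∷
       x^ 0 1 0 1 1 1 ∷ x^ 0 1 0 1 2 0 ∷ x^ 0 1 1 0 1 0 ∷ x^ 0 1 1 0 1 2 ∷ x^ 0 1 1 0 2 1 ∷
       x^ 0 1 1 1 1 1 ∷ x^ 1 0 0 0 0 0 ∷ x^ 1 0 0 0 0 2 ∷ x^ 1 0 0 0 1 0 ∷ x^ 1 0 0 0 1 1 ∷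
       x^ 1 0 0 0 1 2 ∷ x^ 1 0 0 0 2 1 ∷ x^ 1 0 0 1 1 0 ∷ x^ 1 0 0 1 1 1 ∷ x^ 1 0 0 1 2 0 ∷
       x^ 1 0 0 1 2 1 ∷ x^ 1 0 1 0 1 1 ∷ x^ 1 0 1 0 2 1 ∷ x^ 1 0 1 1 1 1 ∷ x^ 1 0 1 1 2 1 ∷
       x^ 1 1 0 0 0 0 ∷ x^ 1 1 0 0 0 2 ∷ x^ 1 1 0 0 1 0 ∷ x^ 1 1 0 0 1 1 ∷ x^ 1 1 0 0 1 2 ∷
       x^ 1 1 0 1 0 2 ∷ x^ 1 1 0 1 1 1 ∷ x^ 1 1 0 1 2 1 ∷ x^ 1 1 0 1 2 2 ∷ x^ 1 1 1 0 1 2 ∷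
       x^ 1 1 1 0 2 2 ∷ x^ 1 1 1 1 1 2 ∷ x^ 1 2 0 0 0 1 ∷ x^ 1 2 0 1 1 2 ∷ x^ 1 2 0 1 2 1 ∷
       x^ 1 2 1 0 2 2 ∷ x^ 2 0 0 0 1 1 ∷ x^ 2 0 0 0 1 2 ∷ x^ 2 0 0 0 2 1 ∷ x^ 2 0 0 0 2 2 ∷
       x^ 2 1 0 0 1 1 ∷ x^ 2 1 0 0 1 2 ∷ x^ 2 1 0 0 2 2 ∷ x^ 2 1 0 1 1 2 ∷ x^ 2 2 0 0 1 2 ∷
       x^ 2 2 1 0 2 2 ∷ [] , σF₁ 0)
    ∷ (x^ 0 0 0 0 0 2 ∷ x^ 0 0 0 1 0 0 ∷ x^ 0 0 1 0 0 0 ∷ x^ 0 0 1 0 0 1 ∷ x^ 0 0 1 1 0 0 ∷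
       x^ 0 0 1 2 0 0 ∷ x^ 0 1 0 0 0 1 ∷ x^ 0 1 0 0 0 2 ∷ x^ 0 1 0 1 0 1 ∷ x^ 0 1 0 1 0 2 ∷
       x^ 0 1 1 0 0 0 ∷ x^ 0 1 1 1 0 0 ∷ x^ 1 0 0 0 0 0 ∷ x^ 1 0 0 0 0 1 ∷ x^ 1 0 0 0 1 2 ∷
       x^ 1 0 0 1 0 1 ∷ x^ 1 0 0 1 0 2 ∷ x^ 1 0 0 1 1 0 ∷ x^ 1 0 1 0 0 1 ∷ x^ 1 0 1 0 1 2 ∷
       x^ 1 0 1 1 0 0 ∷ x^ 1 0 1 2 1 0 ∷ x^ 1 1 0 0 0 1 ∷ x^ 1 1 0 1 0 1 ∷ x^ 1 1 0 1 1 1 ∷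
       x^ 1 1 0 2 0 0 ∷ x^ 1 1 0 2 0 1 ∷ x^ 1 1 1 0 1 1 ∷ x^ 1 1 1 0 1 2 ∷ x^ 1 1 1 1 0 2 ∷
       x^ 1 1 1 1 1 0 ∷ x^ 1 2 0 1 0 2 ∷ x^ 1 2 1 0 0 1 ∷ x^ 1 2 1 1 0 1 ∷ x^ 2 0 0 0 0 1 ∷
       x^ 2 0 0 0 0 2 ∷ x^ 2 0 0 0 1 1 ∷ x^ 2 0 1 0 1 1 ∷ x^ 2 0 1 0 1 2 ∷ x^ 2 1 0 0 0 1 ∷
       x^ 2 1 0 0 0 2 ∷ x^ 2 1 0 1 0 0 ∷ x^ 2 1 0 1 0 2 ∷ x^ 2 1 0 2 1 0 ∷ x^ 2 1 0 2 1 1 ∷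
       x^ 2 1 1 0 0 1 ∷ x^ 2 1 1 0 1 1 ∷ x^ 2 1 1 1 1 1 ∷ x^ 2 2 0 1 0 1 ∷ x^ 2 2 0 1 0 2 ∷
       x^ 2 2 1 1 1 1 ∷ [] , σF₁ 1)
    ∷ (x^ 0 0 0 0 2 0 ∷ x^ 0 0 0 1 0 0 ∷ x^ 0 0 1 0 1 0 ∷ x^ 0 0 1 0 2 0 ∷ x^ 0 1 0 0 0 1 ∷
       x^ 0 1 0 0 1 0 ∷ x^ 0 1 0 0 1 1 ∷ x^ 0 1 0 1 0 0 ∷ x^ 0 1 0 1 1 0 ∷ x^ 0 1 0 1 1 1 ∷
       x^ 0 1 0 1 2 0 ∷ x^ 0 1 1 0 1 0 ∷ x^ 0 1 1 0 2 1 ∷ x^ 0 2 0 0 0 1 ∷ x^ 0 2 0 1 1 0 ∷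
       x^ 0 2 0 1 1 1 ∷ x^ 0 2 1 0 1 1 ∷ x^ 0 2 1 1 1 0 ∷ x^ 0 2 1 1 1 1 ∷ x^ 0 2 1 2 1 0 ∷
       x^ 1 0 0 0 2 0 ∷ x^ 1 0 0 0 2 1 ∷ x^ 1 0 1 0 1 0 ∷ x^ 1 0 1 0 2 0 ∷ x^ 1 1 0 0 1 1 ∷
       x^ 1 1 0 1 2 0 ∷ x^ 1 1 0 1 2 1 ∷ x^ 1 1 1 0 2 1 ∷ x^ 1 2 0 1 1 0 ∷ x^ 1 2 0 2 0 0 ∷
       x^ 2 1 0 0 1 0 ∷ x^ 2 1 0 1 1 0 ∷ x^ 2 2 0 1 1 0 ∷ x^ 2 2 0 2 1 0 ∷ [] , σF₁ 2)
    ∷ (x^ 0 0 0 0 0 1 ∷ x^ 0 0 0 0 1 1 ∷ x^ 0 0 0 1 0 0 ∷ x^ 0 0 0 1 0 1 ∷ x^ 0 0 0 1 1 0 ∷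
       x^ 0 0 0 1 1 1 ∷ x^ 0 0 1 0 0 0 ∷ x^ 0 0 1 0 0 1 ∷ x^ 0 0 1 0 1 0 ∷ x^ 0 0 1 0 2 0 ∷
       x^ 0 0 1 0 2 1 ∷ x^ 0 0 1 1 0 0 ∷ x^ 0 0 1 1 2 0 ∷ x^ 0 0 2 0 1 0 ∷ x^ 0 0 2 0 2 0 ∷
       x^ 0 0 2 2 1 0 ∷ x^ 0 0 2 2 2 0 ∷ x^ 0 1 0 0 1 0 ∷ x^ 0 1 0 1 0 2 ∷ x^ 0 1 1 0 0 0 ∷
       x^ 0 1 1 0 1 0 ∷ x^ 0 1 1 1 0 1 ∷ x^ 0 1 1 1 1 0 ∷ x^ 0 1 1 1 1 2 ∷ x^ 0 1 1 2 0 0 ∷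
       x^ 0 1 1 2 0 1 ∷ x^ 0 1 1 2 1 0 ∷ x^ 0 1 2 0 1 1 ∷ x^ 0 1 2 0 2 1 ∷ x^ 0 1 2 1 1 0 ∷
       x^ 0 1 2 1 1 1 ∷ x^ 0 1 2 2 1 1 ∷ x^ 0 2 0 1 0 2 ∷ x^ 0 2 0 1 1 0 ∷ x^ 0 2 1 0 0 1 ∷
       x^ 0 2 1 0 1 1 ∷ x^ 0 2 1 1 0 0 ∷ x^ 0 2 1 1 1 2 ∷ x^ 0 2 1 2 1 1 ∷ x^ 0 2 1 2 2 0 ∷
       x^ 0 2 2 0 1 0 ∷ x^ 0 2 2 0 1 1 ∷ x^ 1 0 0 0 0 0 ∷ x^ 1 0 0 0 0 1 ∷ x^ 1 0 0 0 1 0 ∷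
       x^ 1 0 0 0 1 1 ∷ x^ 1 0 1 1 1 0 ∷ x^ 1 0 1 1 1 1 ∷ x^ 1 0 1 1 2 0 ∷ x^ 1 0 1 1 2 1 ∷
       x^ 1 1 0 0 0 0 ∷ x^ 1 1 0 0 0 1 ∷ x^ 1 1 0 0 1 1 ∷ x^ 1 1 0 1 0 1 ∷ x^ 1 1 1 0 1 0 ∷
       x^ 1 1 1 1 2 1 ∷ x^ 1 2 0 0 0 1 ∷ x^ 1 2 1 0 1 1 ∷ x^ 1 2 1 1 1 1 ∷ x^ 1 2 2 1 2 1 ∷ [] , σF₁ 3)
    ∷ (x^ 0 0 0 0 0 0 ∷ x^ 0 0 0 1 0 0 ∷ x^ 0 0 0 1 1 0 ∷ x^ 0 0 0 1 1 1 ∷ x^ 0 0 0 1 1 2 ∷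
       x^ 0 0 0 2 1 1 ∷ x^ 0 0 0 2 1 2 ∷ x^ 0 0 1 0 0 0 ∷ x^ 0 0 1 0 1 1 ∷ x^ 0 0 1 1 0 1 ∷
       x^ 0 0 1 1 1 1 ∷ x^ 0 0 1 1 1 2 ∷ x^ 0 0 1 1 2 1 ∷ x^ 0 0 1 1 2 2 ∷ x^ 0 0 1 2 0 1 ∷
       x^ 0 0 1 2 1 1 ∷ x^ 0 1 0 1 0 1 ∷ x^ 0 1 0 2 0 2 ∷ x^ 0 1 0 2 1 0 ∷ x^ 0 1 0 2 1 2 ∷
       x^ 0 1 1 0 0 0 ∷ x^ 0 1 1 1 0 1 ∷ x^ 1 0 0 0 0 0 ∷ x^ 1 0 0 0 0 1 ∷ x^ 1 0 1 0 0 0 ∷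
       x^ 1 0 1 0 1 1 ∷ [] , σF₁ 4)
    ∷ (x^ 0 0 0 0 1 0 ∷ x^ 0 0 0 0 2 1 ∷ x^ 0 0 0 1 1 1 ∷ x^ 0 0 0 1 2 0 ∷ x^ 0 1 0 2 2 0 ∷
       x^ 0 1 0 2 2 1 ∷ x^ 1 0 0 0 1 0 ∷ [] , σF₁ 5)
    ∷ (x^ 0 0 0 0 0 0 ∷ x^ 0 0 0 0 0 2 ∷ x^ 0 0 0 0 1 0 ∷ x^ 0 0 0 0 1 1 ∷ x^ 0 0 0 0 2 1 ∷
       x^ 0 0 0 0 2 2 ∷ x^ 1 0 0 0 2 1 ∷ [] , σH 0)
    ∷ (x^ 1 0 0 0 1 1 ∷ [] , σH 1)
    ∷ []

  A₃A₄+A₁α-certified : norm A₃A₄+A₁α ≡ linearCombination relation certificate-A₃A₄+A₁α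
  A₃A₄+A₁α-certified = ≡.refl

  A₃A₄+A₁^qα^q-certified : norm A₃A₄+A₁^qα^q ≡ linearCombination relation certificate-A₃A₄+A₁^qα^q
  A₃A₄+A₁^qα^q-certified = ≡.refl

  A₃α²+A₄α^q²+A₂αα^q-certified :
    norm A₃α²+A₄α^q²+A₂αα^q ≡ linearCombination relation certificate-A₃α²+A₄α^q²+A₂αα^q
  A₃α²+A₄α^q²+A₂αα^q-certified = ≡.refl

module Factorisation {a ℓ} (K : FiniteField a ℓ) (q : ℕ) where
  open FiniteField K
  open Setup K q using (pow; coeff; _≈ₚ_; F₁; F₂; F₃; A₁; A₂; A₃; A₄; N; α; β; γ; r̄₃; factored)
  open FiniteFieldFacts K q
  open 𝔽₂Poly using (lit; _⊕_; _⊗_; norm; linearCombination)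
  open BaseQ using (σ^; digits; #_; 𝐪^_)
  open Relations
  open import Relation.Binary.Reasoning.Setoid setoid
  open import Algebra.Solver.Ring.NaturalCoefficients.Default commutativeSemiring
    using (solve; _:=_; _:*_; _:+_; con)

  module _ (1+1≈0 : 1# + 1# ≈ 0#) (m : ℕ) (q≡2^m : q ≡ 2 ^ m) (c : Carrier) (c^q⁶≈c : pow c (q ^ 6) ≈ c)
           (c≉0 : c ≉ 0#) (F₁≈0 : F₁ c ≈ 0#) (F₂≈0 : F₂ c ≈ 0#) (F₃≉0 : F₃ c ≉ 0#) where
    open CharacteristicTwo 1+1≈0
    open Conjugates m q≡2^m c c^q⁶≈c

    conjugates-≉0 : ∀ i → Vec.lookup conjugates i ≉ 0#
    conjugates-≉0 i = ≡.subst (_≉ 0#) (≡.sym (Vec.lookup∘tabulate conj i)) (pow-≉0 (q ^ toℕ i) c≉0)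

    F₁≈f₁ : F₁ c ≈ eval conjugates f₁
    F₁≈f₁ = sumPow-value eF₁

    F₂≈f₂ : F₂ c ≈ eval conjugates f₂
    F₂≈f₂ = sumPow-value eF₂

    H≈0 : eval conjugates h ≈ 0#
    H≈0 = *-cancelʳ c^[1+q²]≉0 (begin
      eval conjugates h * eval conjugates c^[1+q²]  ≈⟨ *-comm _ _ ⟩
      ⟦ lit c^[1+q²] ⊗ lit h ⟧ conjugates           ≈⟨ ⟦⟧-cong-norm conjugates (lit c^[1+q²] ⊗ lit h) (lit f₁ ⊕ lit f₂)
                                                                      (≡.sym F₁+F₂≡c^[1+q²]*H) ⟩
      eval conjugates f₁ + eval conjugates f₂       ≈⟨ +-cong (trans (sym F₁≈f₁) F₁≈0) (trans (sym F₂≈f₂) F₂≈0) ⟩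
      0# + 0#                                       ≈⟨ +-identityʳ 0# ⟩
      0#                                            ≈⟨ zeroˡ _ ⟨
      0# * eval conjugates c^[1+q²]                 ∎)
      where
      c^[1+q²]≉0 : eval conjugates c^[1+q²] ≉ 0#
      c^[1+q²]≉0 c^[1+q²]≈0 = evalMonomial-≉0 conjugates (digits (# 1 BaseQ.+ 𝐪^ 2F)) conjugates-≉0
        (trans (sym (+-identityʳ _)) c^[1+q²]≈0)

    relation≈0 : ∀ r → eval conjugates (relation r) ≈ 0#
    relation≈0 (σF₁ k) = eval-σ^-≈0 k (trans (sym F₁≈f₁) F₁≈0)
    relation≈0 (σH  k) = eval-σ^-≈0 k H≈0

    certified : ∀ e cs → norm e ≡ linearCombination relation cs → ⟦ e ⟧ conjugates ≈ 0#
    certified = ⟦⟧≈0 conjugates relation relation≈0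

    N≈f₃ : N c ≈ eval conjugates f₃
    N≈f₃ = trans (+-congˡ (sym (+-identityʳ 1#))) (sumPow-value eF₃)

    α≈α̂ : α c ≈ ⟦ α̂ ⟧ conjugates
    α≈α̂ = trans (pow-cong (q ^ 3) N≈f₃) (eval-σ^ 3 f₃)

    α^q≈N^q⁴ : pow (α c) q ≈ pow (N c) (q ^ 4)
    α^q≈N^q⁴ = sym (pow-* (N c) q (q ^ 3))

    α^q≈α̂^q : pow (α c) q ≈ ⟦ α̂^q ⟧ conjugates
    α^q≈α̂^q = trans α^q≈N^q⁴ (trans (pow-cong (q ^ 4) N≈f₃) (eval-σ^ 4 f₃))

    A₃A₄≈A₁α : A₃ c * A₄ c ≈ A₁ c * α c
    A₃A₄≈A₁α = x+y≈0⇒x≈y (trans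
      (+-cong (*-cong (sumPow-value eA₃) (sumPow-value eA₄)) (*-cong (sumPow-value eA₁) α≈α̂))
      (certified A₃A₄+A₁α certificate-A₃A₄+A₁α A₃A₄+A₁α-certified))

    A₃A₄≈A₁^qα^q : A₃ c * A₄ c ≈ pow (A₁ c) q * pow (α c) q
    A₃A₄≈A₁^qα^q = x+y≈0⇒x≈y (trans
      (+-cong (*-cong (sumPow-value eA₃) (sumPow-value eA₄))
              (*-cong (trans (pow-cong q (sumPow-value eA₁)) (eval-σ a₁)) α^q≈α̂^q))
      (certified A₃A₄+A₁^qα^q certificate-A₃A₄+A₁^qα^q A₃A₄+A₁^qα^q-certified))

    A₃α²+A₄α^q²≈A₂αα^q :
      A₃ c * (α c * α c) + A₄ c * (pow (α c) q * pow (α c) q) ≈ A₂ c * (α c * pow (α c) q)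
    A₃α²+A₄α^q²≈A₂αα^q = x+y≈0⇒x≈y (trans
      (+-cong (+-cong (*-cong (sumPow-value eA₃) (*-cong α≈α̂ α≈α̂))
                      (*-cong (sumPow-value eA₄) (*-cong α^q≈α̂^q α^q≈α̂^q)))
              (*-cong (sumPow-value eA₂) (*-cong α≈α̂ α^q≈α̂^q)))
      (certified A₃α²+A₄α^q²+A₂αα^q certificate-A₃α²+A₄α^q²+A₂αα^q A₃α²+A₄α^q²+A₂αα^q-certified))

    α≉0 : α c ≉ 0#
    α≉0 = pow-≉0 (q ^ 3) (λ N≈0 → F₃≉0 (trans (+-congˡ (+-identityʳ 1#)) N≈0))

    α^q≉0 : pow (α c) q ≉ 0#
    α^q≉0 = pow-≉0 q α≉0

    α^qβ≈A₃ : pow (α c) q * β c ≈ A₃ c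
    α^qβ≈A₃ = trans (solve 3 (λ v x w → v :* (x :* w) := (x :* v) :* w) refl (pow (α c) q) (A₃ c) _)
                    (*-inverse-cancelʳ (A₃ c) α^q≉0)

    αγ≈A₄ : α c * γ c ≈ A₄ c
    αγ≈A₄ = trans (solve 3 (λ u x w → u :* (x :* w) := (x :* u) :* w) refl (α c) (A₄ c) _)
                  (*-inverse-cancelʳ (A₄ c) α≉0)

    A₁≈α^qβγ : A₁ c ≈ (pow (α c) q * β c) * γ c
    A₁≈α^qβγ = sym (begin
      (pow (α c) q * β c) * γ c   ≈⟨ *-congʳ α^qβ≈A₃ ⟩
      A₃ c * (A₄ c * inv (α c))   ≈⟨ *-assoc _ _ _ ⟨
      (A₃ c * A₄ c) * inv (α c)   ≈⟨ *-congʳ A₃A₄≈A₁α ⟩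
      (A₁ c * α c) * inv (α c)    ≈⟨ *-inverse-cancelʳ (A₁ c) α≉0 ⟩
      A₁ c                        ∎)

    A₁^q≈αβγ : pow (A₁ c) q ≈ (α c * β c) * γ c
    A₁^q≈αβγ = sym (begin
      (α c * β c) * γ c                    ≈⟨ solve 3 (λ u b g → (u :* b) :* g := (u :* g) :* b)
                                                      refl (α c) (β c) (γ c) ⟩
      (α c * γ c) * β c                    ≈⟨ *-congʳ αγ≈A₄ ⟩
      A₄ c * (A₃ c * inv v)                ≈⟨ solve 3 (λ x y w → x :* (y :* w) := (y :* x) :* w)
                                                      refl (A₄ c) (A₃ c) (inv v) ⟩
      (A₃ c * A₄ c) * inv v                ≈⟨ *-congʳ A₃A₄≈A₁^qα^q ⟩
      (pow (A₁ c) q * v) * inv v           ≈⟨ *-inverse-cancelʳ (pow (A₁ c) q) α^q≉0 ⟩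
      pow (A₁ c) q                         ∎)
      where
      v : Carrier
      v = pow (α c) q

    A₂≈αβ+α^qγ : A₂ c ≈ (α c * β c) * 1# + (pow (α c) q * 1#) * γ c
    A₂≈αβ+α^qγ = sym (*-cancelʳ (*-≉0 α≉0 α^q≉0) (begin
      ((u * β c) * 1# + (v * 1#) * γ c) * (u * v)
        ≈⟨ solve 4 (λ u v b g → ((u :* b) :* con 1 :+ (v :* con 1) :* g) :* (u :* v)
                              := (u :* u) :* (v :* b) :+ (v :* v) :* (u :* g)) refl u v (β c) (γ c) ⟩
      (u * u) * (v * β c) + (v * v) * (u * γ c)
        ≈⟨ +-cong (*-congˡ α^qβ≈A₃) (*-congˡ αγ≈A₄) ⟩
      (u * u) * A₃ c + (v * v) * A₄ c
        ≈⟨ +-cong (*-comm _ _) (*-comm _ _) ⟩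
      A₃ c * (u * u) + A₄ c * (v * v)
        ≈⟨ A₃α²+A₄α^q²≈A₂αα^q ⟩
      A₂ c * (u * v) ∎))
      where
      u v : Carrier
      u = α c
      v = pow (α c) q

    coefficients : r̄₃ c ≈ₚ factored c
    coefficients i j k =
      trans (coeff-as-sum (r̄₃ c)) (trans termwise (trans reorder (sym (coeff-as-sum (factored c)))))
      where
      open CoefficientAt i j k
      u v : Carrier
      u = α c
      v = pow (α c) q
      -- The coefficients at (i, j, k) of the eight terms of the expanded product,
      -- in the order of expansion; two of them sit at XYZ.
      t₁ t₂ t₃ t₄ t₅ t₆ t₇ t₈ : Carrier
      t₁ = ⟨ ((u * 1#) * 1# , 2 , 2 , 1) ⟩
      t₂ = ⟨ ((u * 1#) * γ c , 2 , 1 , 0) ⟩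
      t₃ = ⟨ ((u * β c) * 1# , 1 , 1 , 1) ⟩
      t₄ = ⟨ ((u * β c) * γ c , 1 , 0 , 0) ⟩
      t₅ = ⟨ ((v * 1#) * 1# , 1 , 2 , 2) ⟩
      t₆ = ⟨ ((v * 1#) * γ c , 1 , 1 , 1) ⟩
      t₇ = ⟨ ((v * β c) * 1# , 0 , 1 , 2) ⟩
      t₈ = ⟨ ((v * β c) * γ c , 0 , 0 , 1) ⟩
      termwise : Σ⟨ r̄₃ c ⟩ ≈ t₈ + (t₄ + ((t₃ + t₆) + (t₇ + (t₅ + (t₂ + (t₁ + 0#))))))
      termwise =
        +-cong (⟨⟩-cong 0 0 1 A₁≈α^qβγ) (+-cong (⟨⟩-cong 1 0 0 A₁^q≈αβγ)
        (+-cong (trans (⟨⟩-cong 1 1 1 A₂≈αβ+α^qγ) (sym (⟨⟩-+ _ _ 1 1 1)))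
        (+-cong (⟨⟩-cong 0 1 2 (sym (trans (*-identityʳ _) α^qβ≈A₃)))
        (+-cong (⟨⟩-cong 1 2 2 (trans (sym α^q≈N^q⁴) (sym (trans (*-identityʳ _) (*-identityʳ _)))))
        (+-cong (⟨⟩-cong 2 1 0 (sym (trans (*-congʳ (*-identityʳ _)) αγ≈A₄)))
        (+-congʳ (⟨⟩-cong 2 2 1 (sym (trans (*-identityʳ _) (*-identityʳ _))))))))))
      reorder : t₈ + (t₄ + ((t₃ + t₆) + (t₇ + (t₅ + (t₂ + (t₁ + 0#)))))) ≈ Σ⟨ factored c ⟩
      reorder = solve 8 (λ t₁ t₂ t₃ t₄ t₅ t₆ t₇ t₈ →
          t₈ :+ (t₄ :+ ((t₃ :+ t₆) :+ (t₇ :+ (t₅ :+ (t₂ :+ (t₁ :+ con 0))))))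
        := t₁ :+ (t₂ :+ (t₃ :+ (t₄ :+ (t₅ :+ (t₆ :+ (t₇ :+ (t₈ :+ con 0))))))))
        refl t₁ t₂ t₃ t₄ t₅ t₆ t₇ t₈

proposition2p4 : {a ℓ : Level} (q : ℕ) → IsPowerOf2 q →
  (K : FiniteField a ℓ) → FiniteField.size K ≡ q ^ 6 →
  (c : FiniteField.Carrier K) →
  ¬ FiniteField._≈_ K (Setup.pow K q c (q ^ 2)) c →
  FiniteField._≈_ K (Setup.F₁ K q c) (FiniteField.0# K) →
  FiniteField._≈_ K (Setup.F₂ K q c) (FiniteField.0# K) →
  ¬ FiniteField._≈_ K (Setup.F₃ K q c) (FiniteField.0# K) →
  Setup._≈ₚ_ K q (Setup.r̄₃ K q c) (Setup.factored K q c)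
proposition2p4 q (m , _ , q≡2^m) K size≡q⁶ c c^q²≉c F₁≈0 F₂≈0 F₃≉0 =
  Factorisation.coefficients K q 1+1≈0 m q≡2^m c c^q⁶≈c c≉0 F₁≈0 F₂≈0 F₃≉0
  where
  open FiniteField K
  open Setup K q using (pow)
  open FiniteFieldFacts K q

  1+1≈0 : 1# + 1# ≈ 0#
  1+1≈0 = characteristic-two (m ℕ.* 6)
    (≡.trans size≡q⁶ (≡.trans (≡.cong (_^ 6) q≡2^m) (ℕ.^-*-assoc 2 m 6)))

  c^q⁶≈c : pow c (q ^ 6) ≈ c
  c^q⁶≈c = trans (reflexive (≡.cong (pow c) (≡.sym size≡q⁶))) (pow-size c)

  c≉0 : c ≉ 0#
  c≉0 c≈0 = c^q²≉c (trans (pow-cong (q ^ 2) c≈0) (trans (pow-q^-0# 2) (sym c≈0)))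
    where open CharacteristicTwo.Conjugates 1+1≈0 m q≡2^m c c^q⁶≈c using (pow-q^-0#)
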